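{- For every $d$ there is an integer $N_d$, depending only on $d$, such that for every triangulated homology $d$-manifold $M$ there is a vertex coloring $c_M:V(D_M)\to\{1,\dots,N_d\}$ of the dual graph $D_M$ of $M$ with the following property: whenever $M,M'$ are triangulated homology $d$-manifolds and there is a graph isomorphism $D_M\to D_{M'}$ carrying $c_M$ to $c_{M'}$, the complexes $M$ and $M'$ are simplicially isomorphic. That is, $(D_M,c_M)$ uniquely determines the simplicial isomorphism type of $M$.
   Context: A triangulated homology $d$-manifold (without boundary) is a simplicial complex in which the link of every $i$-face has the homology of a $(d-i-1)$-sphere. Its dual graph has the $d$-simplices as vertices, two adjacent iff they share a $(d-1)$-simplex. -}

module Defs where

open import Data.Bool using (Bool; true; false; if_then_else_; _∧_; not)
open import Data.Nat using (ℕ; zero; suc; _≤_; _<ᵇ_)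
import Data.Nat as N
open import Data.Integer using (ℤ; +_; _*_; _-_) renaming (_+_ to _+ℤ_)
import Data.Integer as Z
open import Data.Fin using (Fin; toℕ)
open import Data.Fin.Subset using (Subset; _∈_; _∉_; _⊆_; ∣_∣; _∪_; _∩_; ⁅_⁆; ⊥)
open import Data.Vec using (Vec; []; _∷_; lookup; tabulate)
open import Data.Product using (Σ; _×_; ∃; ∃-syntax; _,_; proj₁)
open import Function.Bundles using (_↔_; Inverse)
open import Relation.Binary.PropositionalEquality using (_≡_; _≢_)

record Complex : Set where
  field
    n        : ℕ
    face     : Subset n → Bool
    empty    : face ⊥ ≡ true
    vertices : (v : Fin n) → face ⁅ v ⁆ ≡ true
    down     : (σ τ : Subset n) → σ ⊆ τ → face τ ≡ true → face σ ≡ true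
open Complex public

-- We index by the face
-- size m = (dimension + 1), so that size 0 (the empty face) gives the
-- augmentation, i.e. reduced homology, including degree -1.

sumFin : {n : ℕ} → (Fin n → ℤ) → ℤ
sumFin {zero}  f = + 0
sumFin {suc n} f = f Fin.zero +ℤ sumFin (λ i → f (Fin.suc i))
  where import Data.Fin as Fin

sgn : ℕ → ℤ
sgn zero          = + 1
sgn (suc zero)    = Z.-[1+ 0 ]
sgn (suc (suc k)) = sgn k

below : {n : ℕ} → Fin n → Subset n
below v = tabulate (λ u → toℕ u <ᵇ toℕ v)

ε : {n : ℕ} → Fin n → Subset n → ℤ
ε v τ = sgn ∣ τ ∩ below v ∣

Chain : ℕ → Set
Chain n = Subset n → ℤ

IsChain : {n : ℕ} → (Subset n → Bool) → ℕ → Chain n → Set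
IsChain F m c = ∀ τ → c τ ≢ + 0 → (F τ ≡ true) × (∣ τ ∣ ≡ m)

∂ : {n : ℕ} → Chain n → Chain n
∂ c τ = sumFin (λ v → if lookup τ v then + 0 else ε v τ * c (τ ∪ ⁅ v ⁆))

zeroChain : {n : ℕ} → Chain n → Set
zeroChain c = ∀ τ → c τ ≡ + 0

IsCycle : {n : ℕ} → (Subset n → Bool) → ℕ → Chain n → Set
IsCycle F m c = IsChain F m c × zeroChain (∂ c)

IsBoundary : {n : ℕ} → (Subset n → Bool) → ℕ → Chain n → Set
IsBoundary F m c = ∃[ b ] (IsChain F (suc m) b × (∀ τ → ∂ b τ ≡ c τ))

_-ᶜ_ : {n : ℕ} → Chain n → Chain n → Chain n
(c -ᶜ c') τ = c τ - c' τ

_·ᶜ_ : {n : ℕ} → ℤ → Chain n → Chain n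
(k ·ᶜ c) τ = k * c τ

HomologyZero : {n : ℕ} → (Subset n → Bool) → ℕ → Set
HomologyZero F m = ∀ c → IsCycle F m c → IsBoundary F m c

-- reduced homology in size m is isomorphic to ℤ: there is a cycle z
-- such that k ↦ [k z] is a bijection ℤ → H (surjective and injective)
Homologyℤ : {n : ℕ} → (Subset n → Bool) → ℕ → Set
Homologyℤ F m = ∃[ z ] (IsCycle F m z
  × (∀ c → IsCycle F m c → ∃[ k ] IsBoundary F m (c -ᶜ (k ·ᶜ z)))
  × (∀ k → IsBoundary F m (k ·ᶜ z) → k ≡ + 0))

-- F has the (reduced integral) homology of a sphere of dimension s - 1
-- (s = 0 means the (-1)-sphere, i.e. the complex {∅})
HomologySphere : {n : ℕ} → (Subset n → Bool) → ℕ → Set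
HomologySphere F s = Homologyℤ F s × (∀ m → m ≢ s → HomologyZero F m)

disjoint : {n : ℕ} → Subset n → Subset n → Bool
disjoint σ τ = ∣ σ ∩ τ ∣ N.≡ᵇ 0

link : (K : Complex) → Subset (n K) → Subset (n K) → Bool
link K σ τ = disjoint σ τ ∧ face K (σ ∪ τ)

-- K is a triangulated homology d-manifold (without boundary): for every
-- nonempty face σ (an i-face, |σ| = i + 1) we have i ≤ d and the link of σ
-- has the homology of a (d - i - 1)-sphere, i.e. index d + 1 - |σ|.
IsHomologyManifold : ℕ → Complex → Set
IsHomologyManifold d K = ∀ σ → face K σ ≡ true → 1 ≤ ∣ σ ∣ →
  (∣ σ ∣ ≤ suc d) × HomologySphere (link K σ) (suc d N.∸ ∣ σ ∣)

HomologyManifold : ℕ → Set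
HomologyManifold d = Σ Complex (IsHomologyManifold d)

Facet : ℕ → Complex → Set
Facet d K = Σ (Subset (n K)) (λ σ → (face K σ ≡ true) × (∣ σ ∣ ≡ suc d))

Adjacent : (d : ℕ) (K : Complex) → Facet d K → Facet d K → Set
Adjacent d K (σ , _) (τ , _) = ∣ σ ∩ τ ∣ ≡ d

ColouredDualIso : (d N : ℕ) (K K' : Complex) →
  (Facet d K → Fin N) → (Facet d K' → Fin N) → Set
ColouredDualIso d N K K' c c' = Σ (Facet d K ↔ Facet d K') λ φ →
  let open Inverse φ in
  (∀ x y → Adjacent d K x y → Adjacent d K' (to x) (to y)) ×
  (∀ x y → Adjacent d K' (to x) (to y) → Adjacent d K x y) ×
  (∀ x → c' (to x) ≡ c x)

image : {n n' : ℕ} → (Fin n' → Fin n) → Subset n → Subset n'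
image from σ = tabulate (λ j → lookup σ (from j))

SimpIso : Complex → Complex → Set
SimpIso K K' = Σ (Fin (n K) ↔ Fin (n K')) λ π →
  ∀ σ → face K' (image (Inverse.from π) σ) ≡ face K σ

{-# OPTIONS --safe #-}
-- Order the vertices, so that every vertex of a facet x has a rank in x (its position in x).
-- Colour each facet x by a pair: a colour c x that differs on any two facets at distance
-- at most two in the dual graph (greedily, with (d + 1)² + 1 colours), and the table sending
-- c y, for each neighbour y of x, to the rank in x of the vertex of x not in y. The colours
-- of two adjacent facets thus reveal the ranks of their opposite vertices.
-- Given a colour-preserving isomorphism φ of dual graphs, send a vertex v of a facet x to
-- the vertex of φ x of the same rank. Across a ridge, the ranks of the common vertices are
-- determined by the ranks of the two opposite vertices, so the image of v does not change as
-- x moves through ridges containing v; and any two facets containing v are connected in this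
-- way, because links of faces of codimension at least two have vanishing reduced H₀. The
-- remaining homological input is that the link of a ridge has at most two vertices (its H̃₀
-- is ℤ), which makes the neighbour of x across a given vertex unique, and that every face
-- lies in a facet (the top homology of its link is nonzero).
-- For d = 0 every rank is 0 and one colour suffices.

module Submission where

open import Defs
open import Data.Bool using (Bool; true; false; _∧_; if_then_else_)
import Data.Bool.Properties as Boolₚ
open import Data.Empty using (⊥-elim)
open import Function using (_∘_)
open import Function.Bundles using (Inverse; mk↔ₛ′)
open import Data.Fin as Fin using (Fin; zero; suc; toℕ)
import Data.Fin.Properties as Finₚ
open import Data.Fin.Subset
  using (Subset; _∈_; _∉_; _⊆_; ∣_∣; _∪_; _∩_; ∁; ⁅_⁆; Nonempty) renaming (⊥ to ∅)
open import Data.Fin.Subset.Properties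
open import Data.Integer using (ℤ; 0ℤ; 1ℤ; -1ℤ; -_; +0; +[1+_]; -[1+_])
  renaming (_+_ to _+ℤ_; _*_ to _*ℤ_; _-_ to _-ℤ_)
import Data.Integer.Properties as ℤₚ
open import Data.Integer.Tactic.RingSolver using (solve-∀)
import Data.Nat as ℕ
open import Data.Nat using (ℕ; zero; suc; pred; _+_; _*_; _^_; _∸_; _≤_; _<_; _<ᵇ_; z≤n; s≤s)
import Data.Nat.Properties as ℕₚ
open import Data.List as List using (List; []; _∷_; _++_)
open import Data.List.Membership.Propositional using () renaming (_∈_ to _∈ˡ_)
open import Data.List.Relation.Unary.Any as Any using (here; there)
import Data.List.Relation.Unary.Any.Properties as Anyₚ
open import Data.Product using (Σ; ∃; _×_; _,_; proj₁; proj₂)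
open import Data.Sum using (inj₁; inj₂; [_,_]′)
open import Data.Vec using ([]; _∷_; here; there; lookup)
import Data.Vec.Properties as Vecₚ
open import Relation.Binary.Definitions using (DecidableEquality; tri<; tri≈; tri>)
open import Relation.Binary.PropositionalEquality
open import Relation.Nullary using (¬_; Dec; yes; no; ¬?; does)
open import Relation.Nullary.Decidable using (_×-dec_; dec-true; dec-false; decidable-stable)
import Axiom.UniquenessOfIdentityProofs as UIP

-- Finite subsets and ranks

_≟ₛ_ : ∀ {n} (p q : Subset n) → Dec (p ≡ q)
_≟ₛ_ = Vecₚ.≡-dec Boolₚ._≟_

bit : Bool → ℕ
bit b = if b then 1 else 0

∣p∣≡∣p∩q∣+∣p∩∁q∣ : ∀ {n} (p q : Subset n) → ∣ p ∣ ≡ ∣ p ∩ q ∣ + ∣ p ∩ ∁ q ∣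
∣p∣≡∣p∩q∣+∣p∩∁q∣ []           []           = refl
∣p∣≡∣p∩q∣+∣p∩∁q∣ (true  ∷ p) (true  ∷ q) = cong suc (∣p∣≡∣p∩q∣+∣p∩∁q∣ p q)
∣p∣≡∣p∩q∣+∣p∩∁q∣ (true  ∷ p) (false ∷ q) =
  trans (cong suc (∣p∣≡∣p∩q∣+∣p∩∁q∣ p q)) (sym (ℕₚ.+-suc _ _))
∣p∣≡∣p∩q∣+∣p∩∁q∣ (false ∷ p) (_     ∷ q) = ∣p∣≡∣p∩q∣+∣p∩∁q∣ p q

∣p∩q∣≡0⇒∣p∪q∣≡∣p∣+∣q∣ : ∀ {n} (p q : Subset n) → ∣ p ∩ q ∣ ≡ 0 → ∣ p ∪ q ∣ ≡ ∣ p ∣ + ∣ q ∣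
∣p∩q∣≡0⇒∣p∪q∣≡∣p∣+∣q∣ []           []           _ = refl
∣p∩q∣≡0⇒∣p∪q∣≡∣p∣+∣q∣ (true  ∷ p) (true  ∷ q) ()
∣p∩q∣≡0⇒∣p∪q∣≡∣p∣+∣q∣ (true  ∷ p) (false ∷ q) e = cong suc (∣p∩q∣≡0⇒∣p∪q∣≡∣p∣+∣q∣ p q e)
∣p∩q∣≡0⇒∣p∪q∣≡∣p∣+∣q∣ (false ∷ p) (true  ∷ q) e =
  trans (cong suc (∣p∩q∣≡0⇒∣p∪q∣≡∣p∣+∣q∣ p q e)) (sym (ℕₚ.+-suc _ _))
∣p∩q∣≡0⇒∣p∪q∣≡∣p∣+∣q∣ (false ∷ p) (false ∷ q) e = ∣p∩q∣≡0⇒∣p∪q∣≡∣p∣+∣q∣ p q e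

x∈p⇒∣p∣>0 : ∀ {n} {x : Fin n} {p} → x ∈ p → 0 < ∣ p ∣
x∈p⇒∣p∣>0 here       = s≤s z≤n
x∈p⇒∣p∣>0 {p = b ∷ p} (there x∈p) = ℕₚ.<-≤-trans (x∈p⇒∣p∣>0 x∈p) (∣p∣≤∣x∷p∣ b p)

¬Nonempty⇒∣p∣≡0 : ∀ {n} {p : Subset n} → ¬ Nonempty p → ∣ p ∣ ≡ 0
¬Nonempty⇒∣p∣≡0 {n} ¬ne = trans (cong ∣_∣ (Empty-unique ¬ne)) (∣⊥∣≡0 n)

∣p∩q∣≡0⇒x∉q : ∀ {n} {p q : Subset n} {x} → ∣ p ∩ q ∣ ≡ 0 → x ∈ p → x ∉ q
∣p∩q∣≡0⇒x∉q ∣p∩q∣≡0 x∈p x∈q = ℕₚ.<⇒≢ (x∈p⇒∣p∣>0 (x∈p∩q⁺ (x∈p , x∈q))) (sym ∣p∩q∣≡0)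

∣p∩q∣<∣p∣⇒∃∉ : ∀ {n} (p q : Subset n) → ∣ p ∩ q ∣ < ∣ p ∣ → ∃ λ x → x ∈ p × x ∉ q
∣p∩q∣<∣p∣⇒∃∉ p q ∣p∩q∣<∣p∣ with nonempty? (p ∩ ∁ q)
... | yes (x , x∈p∖q) = x , proj₁ (x∈p∩q⁻ p (∁ q) x∈p∖q) , x∈∁p⇒x∉p (proj₂ (x∈p∩q⁻ p (∁ q) x∈p∖q))
... | no ¬ne = ⊥-elim (ℕₚ.<⇒≢ ∣p∩q∣<∣p∣ (sym (begin
  ∣ p ∣                    ≡⟨ ∣p∣≡∣p∩q∣+∣p∩∁q∣ p q ⟩
  ∣ p ∩ q ∣ + ∣ p ∩ ∁ q ∣  ≡⟨ cong (∣ p ∩ q ∣ +_) (¬Nonempty⇒∣p∣≡0 ¬ne) ⟩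
  ∣ p ∩ q ∣ + 0            ≡⟨ ℕₚ.+-identityʳ _ ⟩
  ∣ p ∩ q ∣                ∎)))
  where open ≡-Reasoning

p⊆q∧∣q∣≤∣p∣⇒p≡q : ∀ {n} {p q : Subset n} → p ⊆ q → ∣ q ∣ ≤ ∣ p ∣ → p ≡ q
p⊆q∧∣q∣≤∣p∣⇒p≡q {p = p} {q} p⊆q ∣q∣≤∣p∣ with Finₚ.any? (λ x → (x ∈? q) ×-dec ¬? (x ∈? p))
... | yes (x , x∈q , x∉p) = ⊥-elim (ℕₚ.<⇒≱ (p⊂q⇒∣p∣<∣q∣ (p⊆q , x , x∈q , x∉p)) ∣q∣≤∣p∣)
... | no ∄x = ⊆-antisym p⊆q q⊆p
  where
  q⊆p : q ⊆ p
  q⊆p {x} x∈q with x ∈? p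
  ... | yes x∈p = x∈p
  ... | no x∉p = ⊥-elim (∄x (x , x∈q , x∉p))

x∈p⇒⁅x⁆⊆p : ∀ {n} {x : Fin n} {p} → x ∈ p → ⁅ x ⁆ ⊆ p
x∈p⇒⁅x⁆⊆p {x = x} x∈p y∈⁅x⁆ rewrite x∈⁅y⁆⇒x≡y x y∈⁅x⁆ = x∈p

∣p∣≡1⇒p≡⁅x⁆ : ∀ {n} {x : Fin n} {p} → ∣ p ∣ ≡ 1 → x ∈ p → p ≡ ⁅ x ⁆
∣p∣≡1⇒p≡⁅x⁆ {x = x} {p} ∣p∣≡1 x∈p =
  sym (p⊆q∧∣q∣≤∣p∣⇒p≡q (x∈p⇒⁅x⁆⊆p x∈p) (subst (∣ p ∣ ≤_) (sym (∣⁅x⁆∣≡1 x)) (ℕₚ.≤-reflexive ∣p∣≡1)))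

∪-least : ∀ {n} {p q r : Subset n} → p ⊆ r → q ⊆ r → p ∪ q ⊆ r
∪-least {p = p} {q} p⊆r q⊆r x∈p∪q with x∈p∪q⁻ p q x∈p∪q
... | inj₁ x∈p = p⊆r x∈p
... | inj₂ x∈q = q⊆r x∈q

x∉p⇒∣p∩⁅x⁆∣≡0 : ∀ {n} {x : Fin n} {p} → x ∉ p → ∣ p ∩ ⁅ x ⁆ ∣ ≡ 0
x∉p⇒∣p∩⁅x⁆∣≡0 {x = x} {p} x∉p with nonempty? (p ∩ ⁅ x ⁆)
... | no ¬ne = ¬Nonempty⇒∣p∣≡0 ¬ne
... | yes (y , y∈p∩⁅x⁆) with x∈p∩q⁻ p ⁅ x ⁆ y∈p∩⁅x⁆
...   | y∈p , y∈⁅x⁆ = ⊥-elim (x∉p (subst (_∈ p) (x∈⁅y⁆⇒x≡y x y∈⁅x⁆) y∈p))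

x∉p⇒∣p∪⁅x⁆∣≡1+∣p∣ : ∀ {n} {x : Fin n} {p} → x ∉ p → ∣ p ∪ ⁅ x ⁆ ∣ ≡ suc ∣ p ∣
x∉p⇒∣p∪⁅x⁆∣≡1+∣p∣ {x = x} {p} x∉p = begin
  ∣ p ∪ ⁅ x ⁆ ∣    ≡⟨ ∣p∩q∣≡0⇒∣p∪q∣≡∣p∣+∣q∣ p ⁅ x ⁆ (x∉p⇒∣p∩⁅x⁆∣≡0 x∉p) ⟩
  ∣ p ∣ + ∣ ⁅ x ⁆ ∣ ≡⟨ cong (∣ p ∣ +_) (∣⁅x⁆∣≡1 x) ⟩
  ∣ p ∣ + 1        ≡⟨ ℕₚ.+-comm ∣ p ∣ 1 ⟩
  suc ∣ p ∣        ∎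
  where open ≡-Reasoning

⁅⁆-injective : ∀ {n} {u a : Fin n} → ⁅ u ⁆ ≡ ⁅ a ⁆ → u ≡ a
⁅⁆-injective {u = u} {a} eq = x∈⁅y⁆⇒x≡y a (subst (u ∈_) eq (x∈⁅x⁆ u))

∣∅∩q∣≡0 : ∀ {n} (q : Subset n) → ∣ ∅ ∩ q ∣ ≡ 0
∣∅∩q∣≡0 {n} q = trans (cong ∣_∣ (∩-zeroˡ q)) (∣⊥∣≡0 n)

p∪⁅y⁆≢⁅z⁆ : ∀ {n} {x y : Fin n} {p} → x ∈ p → y ∉ p → ∀ z → p ∪ ⁅ y ⁆ ≢ ⁅ z ⁆
p∪⁅y⁆≢⁅z⁆ {x = x} {y} {p} x∈p y∉p z eq = y∉p (subst (_∈ p) (sym y≡x) x∈p)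
  where
  in⁅z⁆ : ∀ {w} → w ∈ p ∪ ⁅ y ⁆ → w ≡ z
  in⁅z⁆ w∈ = x∈⁅y⁆⇒x≡y z (subst (_ ∈_) eq w∈)
  y≡x : y ≡ x
  y≡x = trans (in⁅z⁆ (x∈p∪q⁺ (inj₂ (x∈⁅x⁆ y)))) (sym (in⁅z⁆ (x∈p∪q⁺ (inj₁ x∈p))))

∣⁅u⁆∩q∣≡bit : ∀ {n} (u : Fin n) q → ∣ ⁅ u ⁆ ∩ q ∣ ≡ bit (lookup q u)
∣⁅u⁆∩q∣≡bit zero    (true  ∷ q) = cong suc (∣∅∩q∣≡0 q)
∣⁅u⁆∩q∣≡bit zero    (false ∷ q) = ∣∅∩q∣≡0 q
∣⁅u⁆∩q∣≡bit (suc u) (_     ∷ q) = ∣⁅u⁆∩q∣≡bit u q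

rank : ∀ {n} → Subset n → Fin n → ℕ
rank (_ ∷ _) zero    = 0
rank (b ∷ p) (suc x) = bit b + rank p x

rank<∣p∣ : ∀ {n} {x : Fin n} {p} → x ∈ p → rank p x < ∣ p ∣
rank<∣p∣ here                   = s≤s z≤n
rank<∣p∣ {p = true  ∷ p} (there x∈p) = s≤s (rank<∣p∣ x∈p)
rank<∣p∣ {p = false ∷ p} (there x∈p) = rank<∣p∣ x∈p

rank-mono : ∀ {n} {x y : Fin n} {p} → x ∈ p → x Fin.< y → rank p x < rank p y
rank-mono {x = zero}  {suc y} here        _         = s≤s z≤n
rank-mono {x = suc x} {suc y} {b ∷ p} (there x∈p) (s≤s x<y) = ℕₚ.+-monoʳ-< (bit b) (rank-mono x∈p x<y)

rank-injective : ∀ {n} {x y : Fin n} {p} → x ∈ p → y ∈ p → rank p x ≡ rank p y → x ≡ y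
rank-injective {x = x} {y} x∈p y∈p eq with Finₚ.<-cmp x y
... | tri< x<y _ _ = ⊥-elim (ℕₚ.<⇒≢ (rank-mono x∈p x<y) eq)
... | tri≈ _ x≡y _ = x≡y
... | tri> _ _ y<x = ⊥-elim (ℕₚ.<⇒≢ (rank-mono y∈p y<x) (sym eq))

rank-surjective : ∀ {n} (p : Subset n) k → k < ∣ p ∣ → ∃ λ x → x ∈ p × rank p x ≡ k
rank-surjective (true ∷ p) zero _ = zero , here , refl
rank-surjective (true ∷ p) (suc k) (s≤s k<∣p∣) with rank-surjective p k k<∣p∣
... | x , x∈p , eq = suc x , there x∈p , cong suc eq
rank-surjective (false ∷ p) k k<∣p∣ with rank-surjective p k k<∣p∣
... | x , x∈p , eq = suc x , there x∈p , eq

rank≡rank∩+rank∩∁ : ∀ {n} (p q : Subset n) x → rank p x ≡ rank (p ∩ q) x + rank (p ∩ ∁ q) x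
rank≡rank∩+rank∩∁ (b     ∷ p) (c     ∷ q) zero    = refl
rank≡rank∩+rank∩∁ (true  ∷ p) (true  ∷ q) (suc x) = cong suc (rank≡rank∩+rank∩∁ p q x)
rank≡rank∩+rank∩∁ (true  ∷ p) (false ∷ q) (suc x) =
  trans (cong suc (rank≡rank∩+rank∩∁ p q x)) (sym (ℕₚ.+-suc _ _))
rank≡rank∩+rank∩∁ (false ∷ p) (c     ∷ q) (suc x) = rank≡rank∩+rank∩∁ p q x

rank∅ : ∀ {n} (x : Fin n) → rank ∅ x ≡ 0
rank∅ zero    = refl
rank∅ (suc x) = rank∅ x

rank⁅a⁆ : ∀ {n} (a x : Fin n) → rank ⁅ a ⁆ x ≡ bit (toℕ a <ᵇ toℕ x)
rank⁅a⁆ zero    zero    = refl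
rank⁅a⁆ zero    (suc x) = cong suc (rank∅ x)
rank⁅a⁆ (suc a) zero    = refl
rank⁅a⁆ (suc a) (suc x) = rank⁅a⁆ a x

<ᵇ≡true : ∀ {m n} → m < n → (m <ᵇ n) ≡ true
<ᵇ≡true {m} {n} = dec-true (m ℕₚ.<? n)

<ᵇ≡false : ∀ {m n} → n ≤ m → (m <ᵇ n) ≡ false
<ᵇ≡false {m} {n} n≤m = dec-false (m ℕₚ.<? n) (ℕₚ.≤⇒≯ n≤m)

-- The rank that an element of rank r has once the element of rank i is deleted.
dropRank : ℕ → ℕ → ℕ
dropRank i r = if i <ᵇ r then pred r else r

rank≡rank∩+bit : ∀ {n} {p q : Subset n} {a} → p ∩ ∁ q ≡ ⁅ a ⁆ → ∀ w →
                 rank p w ≡ rank (p ∩ q) w + bit (toℕ a <ᵇ toℕ w)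
rank≡rank∩+bit {p = p} {q} {a} p∖q≡⁅a⁆ w = begin
  rank p w                              ≡⟨ rank≡rank∩+rank∩∁ p q w ⟩
  rank (p ∩ q) w + rank (p ∩ ∁ q) w     ≡⟨ cong (λ r → rank (p ∩ q) w + rank r w) p∖q≡⁅a⁆ ⟩
  rank (p ∩ q) w + rank ⁅ a ⁆ w         ≡⟨ cong (rank (p ∩ q) w +_) (rank⁅a⁆ a w) ⟩
  rank (p ∩ q) w + bit (toℕ a <ᵇ toℕ w) ∎
  where open ≡-Reasoning

rank-after-deletion : ∀ {n} {p q : Subset n} {a w} → p ∩ ∁ q ≡ ⁅ a ⁆ → a ∈ p → w ∈ p → w ∈ q →
                      rank (p ∩ q) w ≡ dropRank (rank p a) (rank p w)
rank-after-deletion {p = p} {q} {a} {w} p∖q≡⁅a⁆ a∈p w∈p w∈q with Finₚ.<-cmp a w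
... | tri< a<w _ _ = sym (begin
  dropRank (rank p a) (rank p w)        ≡⟨ cong (λ b → if b then pred (rank p w) else rank p w)
                                                (<ᵇ≡true (rank-mono a∈p a<w)) ⟩
  pred (rank p w)                       ≡⟨ cong pred (rank≡rank∩+bit p∖q≡⁅a⁆ w) ⟩
  pred (rank (p ∩ q) w + bit (toℕ a <ᵇ toℕ w))
                                        ≡⟨ cong (λ b → pred (rank (p ∩ q) w + bit b)) (<ᵇ≡true a<w) ⟩
  pred (rank (p ∩ q) w + 1)             ≡⟨ cong pred (ℕₚ.+-comm (rank (p ∩ q) w) 1) ⟩
  rank (p ∩ q) w                        ∎)
  where open ≡-Reasoning
... | tri≈ _ refl _ = ⊥-elim (x∈∁p⇒x∉p (proj₂ (x∈p∩q⁻ p (∁ q) (subst (a ∈_) (sym p∖q≡⁅a⁆) (x∈⁅x⁆ a)))) w∈q)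
... | tri> _ _ w<a = sym (begin
  dropRank (rank p a) (rank p w)        ≡⟨ cong (λ b → if b then pred (rank p w) else rank p w)
                                                (<ᵇ≡false (ℕₚ.<⇒≤ (rank-mono w∈p w<a))) ⟩
  rank p w                              ≡⟨ rank≡rank∩+bit p∖q≡⁅a⁆ w ⟩
  rank (p ∩ q) w + bit (toℕ a <ᵇ toℕ w) ≡⟨ cong (λ b → rank (p ∩ q) w + bit b) (<ᵇ≡false (ℕₚ.<⇒≤ w<a)) ⟩
  rank (p ∩ q) w + 0                    ≡⟨ ℕₚ.+-identityʳ _ ⟩
  rank (p ∩ q) w                        ∎)
  where open ≡-Reasoning

-- Neighbouring facets and their opposite vertices

record Neighbours {n} (d : ℕ) (x y : Subset n) : Set where
  field
    ∣x∣≡1+d : ∣ x ∣ ≡ suc d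
    ∣y∣≡1+d : ∣ y ∣ ≡ suc d
    ∣x∩y∣≡d : ∣ x ∩ y ∣ ≡ d

Neighbours-sym : ∀ {n d} {x y : Subset n} → Neighbours d x y → Neighbours d y x
Neighbours-sym {x = x} {y} xy = record
  { ∣x∣≡1+d = ∣y∣≡1+d ; ∣y∣≡1+d = ∣x∣≡1+d ; ∣x∩y∣≡d = trans (cong ∣_∣ (∩-comm y x)) ∣x∩y∣≡d }
  where open Neighbours xy

module _ {n d} {x y : Subset n} (xy : Neighbours d x y) where
  open Neighbours xy

  ∣x∩∁y∣≡1 : ∣ x ∩ ∁ y ∣ ≡ 1
  ∣x∩∁y∣≡1 = ℕₚ.+-cancelˡ-≡ d _ _ (begin
    d + ∣ x ∩ ∁ y ∣             ≡⟨ cong (_+ ∣ x ∩ ∁ y ∣) ∣x∩y∣≡d ⟨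
    ∣ x ∩ y ∣ + ∣ x ∩ ∁ y ∣     ≡⟨ ∣p∣≡∣p∩q∣+∣p∩∁q∣ x y ⟨
    ∣ x ∣                       ≡⟨ ∣x∣≡1+d ⟩
    suc d                       ≡⟨ ℕₚ.+-comm 1 d ⟩
    d + 1                       ∎)
    where open ≡-Reasoning

  opposite : ∃ λ a → a ∈ x × a ∉ y
  opposite = ∣p∩q∣<∣p∣⇒∃∉ x y (subst₂ _<_ (sym ∣x∩y∣≡d) (sym ∣x∣≡1+d) (ℕₚ.n<1+n d))

  x∩∁y≡⁅a⁆ : ∀ {a} → a ∈ x → a ∉ y → x ∩ ∁ y ≡ ⁅ a ⁆
  x∩∁y≡⁅a⁆ a∈x a∉y = ∣p∣≡1⇒p≡⁅x⁆ ∣x∩∁y∣≡1 (x∈p∩q⁺ (a∈x , x∉p⇒x∈∁p a∉y))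

  opposite-unique : ∀ {a b} → a ∈ x → a ∉ y → b ∈ x → b ∉ y → b ≡ a
  opposite-unique a∈x a∉y b∈x b∉y =
    x∈⁅y⁆⇒x≡y _ (subst (_ ∈_) (x∩∁y≡⁅a⁆ a∈x a∉y) (x∈p∩q⁺ (b∈x , x∉p⇒x∈∁p b∉y)))

ridge-∪-opposite : ∀ {n d} {x y : Subset n} {b} → Neighbours d x y → b ∈ y → b ∉ x → (x ∩ y) ∪ ⁅ b ⁆ ≡ y
ridge-∪-opposite {x = x} {y} xy b∈y b∉x = ⊆-antisym (∪-least (p∩q⊆q x y) (x∈p⇒⁅x⁆⊆p b∈y)) y⊆
  where
  y⊆ : y ⊆ (x ∩ y) ∪ ⁅ _ ⁆
  y⊆ {z} z∈y with z ∈? x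
  ... | yes z∈x = x∈p∪q⁺ (inj₁ (x∈p∩q⁺ (z∈x , z∈y)))
  ... | no z∉x  = x∈p∪q⁺ (inj₂ (subst (_∈ ⁅ _ ⁆) (sym z≡b) (x∈⁅x⁆ _)))
    where z≡b = opposite-unique (Neighbours-sym xy) b∈y b∉x z∈y z∉x

ridge-⊆ : ∀ {n d} {x y y′ : Subset n} {a} → Neighbours d x y′ → a ∈ x → a ∉ y → a ∉ y′ → x ∩ y ⊆ x ∩ y′
ridge-⊆ {x = x} {y} {y′} xy′ a∈x a∉y a∉y′ z∈x∩y with x∈p∩q⁻ x y z∈x∩y
... | z∈x , z∈y with _ ∈? y′
...   | yes z∈y′ = x∈p∩q⁺ (z∈x , z∈y′)
...   | no z∉y′  = ⊥-elim (a∉y (subst (_∈ y) (opposite-unique xy′ a∈x a∉y′ z∈x z∉y′) z∈y))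

SameRank : ∀ {n n′} → Subset n → Fin n → Subset n′ → Fin n′ → Set
SameRank x v x′ w = w ∈ x′ × rank x′ w ≡ rank x v

OppositeRanksAgree : ∀ {n n′} → Subset n → Subset n → Subset n′ → Subset n′ → Set
OppositeRanksAgree x y x′ y′ = ∀ {a a′} → a ∈ x → a ∉ y → a′ ∈ x′ → a′ ∉ y′ → rank x a ≡ rank x′ a′

module _ {n n′ d} {x y : Subset n} {x′ y′ : Subset n′}
         (xy : Neighbours d x y) (x′y′ : Neighbours d x′ y′) (agree : OppositeRanksAgree x y x′ y′)
         {v w} (v∈x : v ∈ x) (v∈y : v ∈ y) (w≈v : SameRank x v x′ w) where

  private
    a  = proj₁ (opposite xy)
    a′ = proj₁ (opposite x′y′)
    a∈x   = proj₁ (proj₂ (opposite xy))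
    a∉y   = proj₂ (proj₂ (opposite xy))
    a′∈x′ = proj₁ (proj₂ (opposite x′y′))
    a′∉y′ = proj₂ (proj₂ (opposite x′y′))
    w∈x′ = proj₁ w≈v
    w~v  = proj₂ w≈v

  ridge-vertex-stays : w ∈ y′
  ridge-vertex-stays with w ∈? y′
  ... | yes w∈y′ = w∈y′
  ... | no w∉y′ = ⊥-elim (a∉y (subst (_∈ y) v≡a v∈y))
    where
    v≡a : v ≡ a
    v≡a = rank-injective v∈x a∈x (begin
      rank x v    ≡⟨ w~v ⟨
      rank x′ w   ≡⟨ cong (rank x′) (opposite-unique x′y′ a′∈x′ a′∉y′ w∈x′ w∉y′) ⟩
      rank x′ a′  ≡⟨ agree a∈x a∉y a′∈x′ a′∉y′ ⟨
      rank x a    ∎)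
      where open ≡-Reasoning

  ridge-rank : rank (x′ ∩ y′) w ≡ rank (x ∩ y) v
  ridge-rank = begin
    rank (x′ ∩ y′) w                        ≡⟨ rank-after-deletion (x∩∁y≡⁅a⁆ x′y′ a′∈x′ a′∉y′)
                                                                   a′∈x′ w∈x′ ridge-vertex-stays ⟩
    dropRank (rank x′ a′) (rank x′ w)       ≡⟨ cong₂ dropRank (agree a∈x a∉y a′∈x′ a′∉y′) (sym w~v) ⟨
    dropRank (rank x a) (rank x v)          ≡⟨ rank-after-deletion (x∩∁y≡⁅a⁆ xy a∈x a∉y) a∈x v∈x v∈y ⟨
    rank (x ∩ y) v                          ∎
    where open ≡-Reasoning

-- Ranks in the ridge x ∩ y are determined by ranks in x and the rank of the vertex
-- opposite to y, so w and w′ get the same rank in the ridge x′ ∩ y′.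
rank-transfer : ∀ {n n′ d} {x y : Subset n} {x′ y′ : Subset n′} →
  Neighbours d x y → Neighbours d x′ y′ →
  OppositeRanksAgree x y x′ y′ → OppositeRanksAgree y x y′ x′ →
  ∀ {v w w′} → v ∈ x → v ∈ y → SameRank x v x′ w → SameRank y v y′ w′ → w ≡ w′
rank-transfer {x = x} {y} {x′} {y′} xy x′y′ agree agree˘ {v} {w} {w′} v∈x v∈y w≈v w′≈v =
  rank-injective (x∈p∩q⁺ (proj₁ w≈v , ridge-vertex-stays xy x′y′ agree v∈x v∈y w≈v))
                 (x∈p∩q⁺ (ridge-vertex-stays yx y′x′ agree˘ v∈y v∈x w′≈v , proj₁ w′≈v))
                 (begin
    rank (x′ ∩ y′) w   ≡⟨ ridge-rank xy x′y′ agree v∈x v∈y w≈v ⟩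
    rank (x ∩ y) v     ≡⟨ cong (λ r → rank r v) (∩-comm x y) ⟩
    rank (y ∩ x) v     ≡⟨ ridge-rank yx y′x′ agree˘ v∈y v∈x w′≈v ⟨
    rank (y′ ∩ x′) w′  ≡⟨ cong (λ r → rank r w′) (∩-comm y′ x′) ⟩
    rank (x′ ∩ y′) w′  ∎)
  where
  open ≡-Reasoning
  yx = Neighbours-sym xy
  y′x′ = Neighbours-sym x′y′

-- Chains and reduced homology

sumFin-cong : ∀ {n} {f g : Fin n → ℤ} → (∀ i → f i ≡ g i) → sumFin f ≡ sumFin g
sumFin-cong {zero}  f≗g = refl
sumFin-cong {suc n} f≗g = cong₂ _+ℤ_ (f≗g zero) (sumFin-cong (λ i → f≗g (suc i)))

sumFin-zero : ∀ {n} {f : Fin n → ℤ} → (∀ i → f i ≡ 0ℤ) → sumFin f ≡ 0ℤ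
sumFin-zero {zero}  f≗0 = refl
sumFin-zero {suc n} f≗0 = cong₂ _+ℤ_ (f≗0 zero) (sumFin-zero (λ i → f≗0 (suc i)))

sumFin-+ : ∀ {n} (f g : Fin n → ℤ) → sumFin (λ i → f i +ℤ g i) ≡ sumFin f +ℤ sumFin g
sumFin-+ {zero}  f g = refl
sumFin-+ {suc n} f g = trans (cong (f zero +ℤ g zero +ℤ_) (sumFin-+ (λ i → f (suc i)) (λ i → g (suc i))))
                             (interchange (f zero) (g zero) _ _)
  where
  interchange : ∀ a b c d → (a +ℤ b) +ℤ (c +ℤ d) ≡ (a +ℤ c) +ℤ (b +ℤ d)
  interchange = solve-∀

sumFin-neg : ∀ {n} (f : Fin n → ℤ) → sumFin (λ i → - f i) ≡ - sumFin f
sumFin-neg {zero}  f = refl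
sumFin-neg {suc n} f = trans (cong (- f zero +ℤ_) (sumFin-neg (λ i → f (suc i))))
                             (sym (ℤₚ.neg-distrib-+ (f zero) _))

sumFin-*ˡ : ∀ {n} k (f : Fin n → ℤ) → sumFin (λ i → k *ℤ f i) ≡ k *ℤ sumFin f
sumFin-*ˡ {zero}  k f = sym (ℤₚ.*-zeroʳ k)
sumFin-*ˡ {suc n} k f = trans (cong (k *ℤ f zero +ℤ_) (sumFin-*ˡ k (λ i → f (suc i))))
                              (sym (ℤₚ.*-distribˡ-+ k (f zero) _))

sumFin-comm : ∀ {m n} (g : Fin m → Fin n → ℤ) →
              sumFin (λ i → sumFin (g i)) ≡ sumFin (λ j → sumFin (λ i → g i j))
sumFin-comm {zero} {n} g = sym (sumFin-zero {n} (λ _ → refl))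
sumFin-comm {suc m} g = trans (cong (sumFin (g zero) +ℤ_) (sumFin-comm (λ i → g (suc i))))
                              (sym (sumFin-+ (g zero) _))

sumFin-single : ∀ {n} (f : Fin n → ℤ) a → (∀ u → u ≢ a → f u ≡ 0ℤ) → sumFin f ≡ f a
sumFin-single f zero f≗0 =
  trans (cong (f zero +ℤ_) (sumFin-zero (λ i → f≗0 (suc i) (λ ())))) (ℤₚ.+-identityʳ (f zero))
sumFin-single f (suc a) f≗0 =
  trans (cong (_+ℤ sumFin (λ i → f (suc i))) (f≗0 zero (λ ())))
        (trans (ℤₚ.+-identityˡ _)
               (sumFin-single (λ i → f (suc i)) a (λ u u≢a → f≗0 (suc u) (u≢a ∘ Finₚ.suc-injective))))

sumFin-antisymmetric : ∀ {n} (g : Fin n → Fin n → ℤ) → (∀ u w → g u w ≡ - g w u) →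
                       sumFin (λ u → sumFin (g u)) ≡ 0ℤ
sumFin-antisymmetric {n} g anti = self-negative (begin
  S                                        ≡⟨ sumFin-cong (λ u → sumFin-cong (anti u)) ⟩
  sumFin (λ u → sumFin (λ w → - g w u))    ≡⟨ sumFin-cong (λ u → sumFin-neg (λ w → g w u)) ⟩
  sumFin (λ u → - sumFin (λ w → g w u))    ≡⟨ sumFin-neg {n} (λ u → sumFin (λ w → g w u)) ⟩
  - sumFin (λ u → sumFin (λ w → g w u))    ≡⟨ cong -_ (sumFin-comm g) ⟨
  - S                                      ∎)
  where
  open ≡-Reasoning
  S = sumFin (λ u → sumFin (g u))
  self-negative : ∀ {i} → i ≡ - i → i ≡ 0ℤ
  self-negative {+0}  _ = refl
  self-negative {+[1+ _ ]} ()
  self-negative { -[1+ _ ]} ()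

1ℤ≢0ℤ : 1ℤ ≢ 0ℤ
1ℤ≢0ℤ ()

point : ∀ {n} → Fin n → Chain n
point a τ = if does (τ ≟ₛ ⁅ a ⁆) then 1ℤ else 0ℤ

point-⁅a⁆ : ∀ {n} (a : Fin n) → point a ⁅ a ⁆ ≡ 1ℤ
point-⁅a⁆ a = cong (if_then 1ℤ else 0ℤ) (dec-true (⁅ a ⁆ ≟ₛ ⁅ a ⁆) refl)

point-≢ : ∀ {n} {a : Fin n} {τ} → τ ≢ ⁅ a ⁆ → point a τ ≡ 0ℤ
point-≢ {a = a} {τ} τ≢⁅a⁆ = cong (if_then 1ℤ else 0ℤ) (dec-false (τ ≟ₛ ⁅ a ⁆) τ≢⁅a⁆)

sumFin-*point : ∀ {n} (h : Fin n → ℤ) a → sumFin (λ u → h u *ℤ point a ⁅ u ⁆) ≡ h a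
sumFin-*point h a = trans
  (sumFin-single _ a (λ u u≢a → trans (cong (h u *ℤ_) (point-≢ (u≢a ∘ ⁅⁆-injective))) (ℤₚ.*-zeroʳ (h u))))
  (trans (cong (h a *ℤ_) (point-⁅a⁆ a)) (ℤₚ.*-identityʳ (h a)))

sumFin-*point-difference : ∀ {n} (h : Fin n → ℤ) a a′ →
  sumFin (λ u → h u *ℤ (point a -ᶜ point a′) ⁅ u ⁆) ≡ h a -ℤ h a′
sumFin-*point-difference {n} h a a′ = begin
  sumFin (λ u → h u *ℤ (point a ⁅ u ⁆ -ℤ point a′ ⁅ u ⁆))
    ≡⟨ sumFin-cong (λ u → distrib (h u) _ _) ⟩
  sumFin (λ u → h u *ℤ point a ⁅ u ⁆ +ℤ - (h u *ℤ point a′ ⁅ u ⁆))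
    ≡⟨ sumFin-+ {n} (λ u → h u *ℤ point a ⁅ u ⁆) (λ u → - (h u *ℤ point a′ ⁅ u ⁆)) ⟩
  sumFin (λ u → h u *ℤ point a ⁅ u ⁆) +ℤ sumFin (λ u → - (h u *ℤ point a′ ⁅ u ⁆))
    ≡⟨ cong₂ _+ℤ_ (sumFin-*point h a)
                  (trans (sumFin-neg {n} (λ u → h u *ℤ point a′ ⁅ u ⁆)) (cong -_ (sumFin-*point h a′))) ⟩
  h a -ℤ h a′ ∎
  where
  open ≡-Reasoning
  distrib : ∀ x y z → x *ℤ (y -ℤ z) ≡ x *ℤ y +ℤ - (x *ℤ z)
  distrib = solve-∀

∂-zeroChain : ∀ {n} {c : Chain n} → zeroChain c → zeroChain (∂ c)
∂-zeroChain {c = c} c≗0 τ = sumFin-zero term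
  where
  term : ∀ v → (if lookup τ v then 0ℤ else ε v τ *ℤ c (τ ∪ ⁅ v ⁆)) ≡ 0ℤ
  term v with lookup τ v
  ... | true  = refl
  ... | false = trans (cong (ε v τ *ℤ_) (c≗0 _)) (ℤₚ.*-zeroʳ (ε v τ))

∂-point-difference : ∀ {n} (a a′ : Fin n) → zeroChain (∂ (point a -ᶜ point a′))
∂-point-difference {n} a a′ τ with nonempty? τ
... | no τ-empty = begin
  ∂ c τ                          ≡⟨ cong (∂ c) (Empty-unique τ-empty) ⟩
  ∂ c ∅                          ≡⟨ sumFin-cong term ⟩
  sumFin (λ v → 1ℤ *ℤ c ⁅ v ⁆)   ≡⟨ sumFin-*point-difference (λ _ → 1ℤ) a a′ ⟩
  0ℤ                             ∎
  where
  open ≡-Reasoning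
  c = point a -ᶜ point a′
  term : ∀ v → (if lookup ∅ v then 0ℤ else ε v ∅ *ℤ c (∅ ∪ ⁅ v ⁆)) ≡ 1ℤ *ℤ c ⁅ v ⁆
  term v rewrite Vecₚ.lookup-replicate v false | ∪-identityˡ ⁅ v ⁆ | ∣∅∩q∣≡0 (below v) = refl
... | yes (t , t∈τ) = sumFin-zero term
  where
  term : ∀ v → (if lookup τ v then 0ℤ else ε v τ *ℤ (point a -ᶜ point a′) (τ ∪ ⁅ v ⁆)) ≡ 0ℤ
  term v with lookup τ v in v∈?τ
  ... | true  = refl
  ... | false =
    trans (cong (ε v τ *ℤ_) (cong₂ _-ℤ_ (point-≢ (not-singleton a)) (point-≢ (not-singleton a′))))
          (ℤₚ.*-zeroʳ (ε v τ))
    where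
    v∉τ : v ∉ τ
    v∉τ v∈τ with trans (sym (Vecₚ.[]=⇒lookup v∈τ)) v∈?τ
    ... | ()
    not-singleton : ∀ b → τ ∪ ⁅ v ⁆ ≢ ⁅ b ⁆
    not-singleton = p∪⁅y⁆≢⁅z⁆ t∈τ v∉τ

point-difference-isCycle : ∀ {n} {F : Subset n → Bool} {a a′} → F ⁅ a ⁆ ≡ true → F ⁅ a′ ⁆ ≡ true →
                           IsCycle F 1 (point a -ᶜ point a′)
point-difference-isCycle {a = a} {a′} Fa Fa′ = isChain , ∂-point-difference a a′
  where
  isChain : IsChain _ 1 (point a -ᶜ point a′)
  isChain τ c≢0 with τ ≟ₛ ⁅ a ⁆ | τ ≟ₛ ⁅ a′ ⁆
  ... | yes refl | _        = Fa , ∣⁅x⁆∣≡1 a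
  ... | no _     | yes refl = Fa′ , ∣⁅x⁆∣≡1 a′
  ... | no _     | no _     = ⊥-elim (c≢0 refl)

ε-⁅u⁆ : ∀ {n} (u w : Fin n) → ε w ⁅ u ⁆ ≡ sgn (bit (toℕ u <ᵇ toℕ w))
ε-⁅u⁆ u w = cong sgn (trans (∣⁅u⁆∩q∣≡bit u (below w))
                            (cong bit (Vecₚ.lookup∘tabulate (λ v → toℕ v <ᵇ toℕ w) u)))

ε-⁅⁆-antisym : ∀ {n} {u w : Fin n} → u ≢ w → ε w ⁅ u ⁆ ≡ - ε u ⁅ w ⁆
ε-⁅⁆-antisym {u = u} {w} u≢w rewrite ε-⁅u⁆ u w | ε-⁅u⁆ w u with Finₚ.<-cmp u w
... | tri< u<w _ _ rewrite <ᵇ≡true u<w | <ᵇ≡false (ℕₚ.<⇒≤ u<w) = refl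
... | tri≈ _ u≡w _ = ⊥-elim (u≢w u≡w)
... | tri> _ _ w<u rewrite <ᵇ≡true w<u | <ᵇ≡false (ℕₚ.<⇒≤ w<u) = refl

-- On vertices, ∂b is a sum over the edges of b with antisymmetric signs, so pairing it
-- with a weight that is constant along those edges gives zero.
pairing-∂-edge-constant : ∀ {n} (b : Chain n) (t : Fin n → ℤ) →
  (∀ {u w} → u ≢ w → t u *ℤ b (⁅ u ⁆ ∪ ⁅ w ⁆) ≡ t w *ℤ b (⁅ u ⁆ ∪ ⁅ w ⁆)) →
  sumFin (λ u → t u *ℤ ∂ b ⁅ u ⁆) ≡ 0ℤ
pairing-∂-edge-constant {n} b t t-constant =
  trans (sumFin-cong (λ u → sym (sumFin-*ˡ (t u) (edge u)))) (sumFin-antisymmetric g g-antisym)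
  where
  open ≡-Reasoning

  edge : Fin n → Fin n → ℤ
  edge u w = if lookup ⁅ u ⁆ w then 0ℤ else ε w ⁅ u ⁆ *ℤ b (⁅ u ⁆ ∪ ⁅ w ⁆)

  edge-≢ : ∀ {u w} → u ≢ w → edge u w ≡ ε w ⁅ u ⁆ *ℤ b (⁅ u ⁆ ∪ ⁅ w ⁆)
  edge-≢ {u} {w} u≢w with lookup ⁅ u ⁆ w in w∈?⁅u⁆
  ... | false = refl
  ... | true  = ⊥-elim (u≢w (sym (x∈⁅y⁆⇒x≡y u (Vecₚ.lookup⇒[]= w ⁅ u ⁆ w∈?⁅u⁆))))

  g : Fin n → Fin n → ℤ
  g u w = t u *ℤ edge u w

  g-antisym : ∀ u w → g u w ≡ - g w u
  g-antisym u w with u Fin.≟ w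
  ... | yes refl rewrite Vecₚ.[]=⇒lookup (x∈⁅x⁆ u) | ℤₚ.*-zeroʳ (t u) = refl
  ... | no u≢w = begin
    t u *ℤ edge u w                              ≡⟨ cong (t u *ℤ_) (edge-≢ u≢w) ⟩
    t u *ℤ (ε w ⁅ u ⁆ *ℤ β)                      ≡⟨ reassoc (t u) (ε w ⁅ u ⁆) β ⟩
    ε w ⁅ u ⁆ *ℤ (t u *ℤ β)                      ≡⟨ cong₂ _*ℤ_ (ε-⁅⁆-antisym u≢w) (t-constant u≢w) ⟩
    - ε u ⁅ w ⁆ *ℤ (t w *ℤ β)                    ≡⟨ negate (ε u ⁅ w ⁆) (t w) β ⟩
    - (t w *ℤ (ε u ⁅ w ⁆ *ℤ β))                  ≡⟨ cong (λ σ → - (t w *ℤ (ε u ⁅ w ⁆ *ℤ b σ)))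
                                                         (∪-comm ⁅ u ⁆ ⁅ w ⁆) ⟩
    - (t w *ℤ (ε u ⁅ w ⁆ *ℤ b (⁅ w ⁆ ∪ ⁅ u ⁆)))  ≡⟨ cong (λ e → - (t w *ℤ e)) (edge-≢ (u≢w ∘ sym)) ⟨
    - (t w *ℤ edge w u)                          ∎
    where
    β = b (⁅ u ⁆ ∪ ⁅ w ⁆)
    reassoc : ∀ x e y → x *ℤ (e *ℤ y) ≡ e *ℤ (x *ℤ y)
    reassoc = solve-∀
    negate : ∀ e x y → - e *ℤ (x *ℤ y) ≡ - (x *ℤ (e *ℤ y))
    negate = solve-∀

EdgeClosed : ∀ {n} → (Subset n → Bool) → (Fin n → Set) → Set
EdgeClosed F T = ∀ {u w} → u ≢ w → F (⁅ u ⁆ ∪ ⁅ w ⁆) ≡ true → T u → T w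

-- Pairing ∂b = [a] − [a′] with the indicator t of T gives t a − t a′, which must vanish.
EdgeClosed-bounding : ∀ {n} {F : Subset n → Bool} {T : Fin n → Set} →
  (∀ u → Dec (T u)) → EdgeClosed F T →
  ∀ {a a′} → IsBoundary F 1 (point a -ᶜ point a′) → T a → T a′
EdgeClosed-bounding {n} {F} {T} T? closed {a} {a′} (b , b-chain , ∂b≡) Ta with T? a′
... | yes Ta′ = Ta′
... | no ¬Ta′ = ⊥-elim (1ℤ≢0ℤ (begin
  1ℤ                                                ≡⟨ cong₂ _-ℤ_ (indicator (dec-true (T? a) Ta))
                                                                  (indicator (dec-false (T? a′) ¬Ta′)) ⟨
  t a -ℤ t a′                                       ≡⟨ sumFin-*point-difference t a a′ ⟨
  sumFin (λ u → t u *ℤ (point a -ᶜ point a′) ⁅ u ⁆) ≡⟨ sumFin-cong (λ u → cong (t u *ℤ_) (∂b≡ ⁅ u ⁆)) ⟨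
  sumFin (λ u → t u *ℤ ∂ b ⁅ u ⁆)                   ≡⟨ pairing-∂-edge-constant b t t-constant ⟩
  0ℤ                                                ∎))
  where
  open ≡-Reasoning

  t : Fin n → ℤ
  t u = if does (T? u) then 1ℤ else 0ℤ

  indicator : ∀ {b c} → b ≡ c → (if b then 1ℤ else 0ℤ) ≡ (if c then 1ℤ else 0ℤ)
  indicator = cong (if_then 1ℤ else 0ℤ)

  t-constant : ∀ {u w} → u ≢ w → t u *ℤ b (⁅ u ⁆ ∪ ⁅ w ⁆) ≡ t w *ℤ b (⁅ u ⁆ ∪ ⁅ w ⁆)
  t-constant {u} {w} u≢w with b (⁅ u ⁆ ∪ ⁅ w ⁆) ℤₚ.≟ 0ℤ
  ... | yes b≡0 rewrite b≡0 = trans (ℤₚ.*-zeroʳ (t u)) (sym (ℤₚ.*-zeroʳ (t w)))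
  ... | no b≢0 = cong (_*ℤ b (⁅ u ⁆ ∪ ⁅ w ⁆)) t-edge
    where
    isEdge : F (⁅ u ⁆ ∪ ⁅ w ⁆) ≡ true
    isEdge = proj₁ (b-chain _ b≢0)
    t-edge : t u ≡ t w
    t-edge with T? u | T? w
    ... | yes _  | yes _  = refl
    ... | no _   | no _   = refl
    ... | yes Tu | no ¬Tw = ⊥-elim (¬Tw (closed u≢w isEdge Tu))
    ... | no ¬Tu | yes Tw =
      ⊥-elim (¬Tu (closed (u≢w ∘ sym) (subst (λ σ → F σ ≡ true) (∪-comm ⁅ u ⁆ ⁅ w ⁆) isEdge) Tw))

-- Homology manifolds

Homologyℤ⇒face : ∀ {n} {F : Subset n → Bool} {m} → Homologyℤ F m → ∃ λ τ → F τ ≡ true × ∣ τ ∣ ≡ m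
Homologyℤ⇒face {F = F} {m} (z , (z-chain , _) , _ , injective) with anySubset? (λ τ → ¬? (z τ ℤₚ.≟ 0ℤ))
... | yes (τ , zτ≢0) = τ , z-chain τ zτ≢0
... | no ∄τ = ⊥-elim (1ℤ≢0ℤ (injective 1ℤ z-bounds))
  where
  z-bounds : IsBoundary F m (1ℤ ·ᶜ z)
  z-bounds = (λ _ → 0ℤ) , (λ _ 0≢0 → ⊥-elim (0≢0 refl)) , λ τ →
    trans (∂-zeroChain (λ _ → refl) τ)
          (sym (trans (ℤₚ.*-identityˡ (z τ)) (decidable-stable (z τ ℤₚ.≟ 0ℤ) (λ zτ≢0 → ∄τ (τ , zτ≢0)))))

boundary-without-edges : ∀ {n} {F : Subset n → Bool} → (∀ τ → F τ ≡ true → ∣ τ ∣ ≢ 2) →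
                         ∀ {x} → IsBoundary F 1 x → zeroChain x
boundary-without-edges no-edges (e , e-chain , ∂e≡x) τ = trans (sym (∂e≡x τ)) (∂-zeroChain e≗0 τ)
  where
  e≗0 : zeroChain e
  e≗0 σ = decidable-stable (e σ ℤₚ.≟ 0ℤ) λ eσ≢0 →
    no-edges σ (proj₁ (e-chain σ eσ≢0)) (proj₂ (e-chain σ eσ≢0))

-- [a] − [b] and [a] − [c] are multiples k z and l z of the generator; evaluating at a
-- and b gives l ≢ 0 and z ⁅ b ⁆ ≢ 0, so [a] − [c] cannot vanish at b unless b ≡ c.
Homologyℤ₁-two-vertices : ∀ {n} {F : Subset n → Bool} → Homologyℤ F 1 → (∀ τ → F τ ≡ true → ∣ τ ∣ ≢ 2) →
  ∀ {a b c} → F ⁅ a ⁆ ≡ true → F ⁅ b ⁆ ≡ true → F ⁅ c ⁆ ≡ true → a ≢ b → a ≢ c → b ≡ c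
Homologyℤ₁-two-vertices {F = F} (z , _ , generates , _) no-edges {a} {b} {c} Fa Fb Fc a≢b a≢c
  with b Fin.≟ c
... | yes b≡c = b≡c
... | no b≢c = ⊥-elim ([ l≢0 , zb≢0 ]′ (ℤₚ.i*j≡0⇒i≡0∨j≡0 l lzb≡0))
  where
  open ≡-Reasoning

  multiple : ∀ {u} → F ⁅ u ⁆ ≡ true → ∃ λ k → ∀ τ → point a τ -ℤ point u τ ≡ k *ℤ z τ
  multiple Fu with generates _ (point-difference-isCycle Fa Fu)
  ... | k , bounds = k , λ τ → ℤₚ.i-j≡0⇒i≡j _ _ (boundary-without-edges no-edges bounds τ)

  k = proj₁ (multiple Fb)
  l = proj₁ (multiple Fc)

  lzb≡0 : l *ℤ z ⁅ b ⁆ ≡ 0ℤ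
  lzb≡0 = trans (sym (proj₂ (multiple Fc) ⁅ b ⁆))
                (cong₂ _-ℤ_ (point-≢ (a≢b ∘ sym ∘ ⁅⁆-injective)) (point-≢ (b≢c ∘ ⁅⁆-injective)))

  l≢0 : l ≢ 0ℤ
  l≢0 l≡0 = 1ℤ≢0ℤ (begin
    1ℤ                             ≡⟨ cong₂ _-ℤ_ (point-⁅a⁆ a) (point-≢ (a≢c ∘ ⁅⁆-injective)) ⟨
    point a ⁅ a ⁆ -ℤ point c ⁅ a ⁆ ≡⟨ proj₂ (multiple Fc) ⁅ a ⁆ ⟩
    l *ℤ z ⁅ a ⁆                   ≡⟨ cong (_*ℤ z ⁅ a ⁆) l≡0 ⟩
    0ℤ                             ∎)

  zb≢0 : z ⁅ b ⁆ ≢ 0ℤ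
  zb≢0 zb≡0 = -1≢0 (begin
    -1ℤ                            ≡⟨ cong₂ _-ℤ_ (point-≢ (a≢b ∘ sym ∘ ⁅⁆-injective)) (point-⁅a⁆ b) ⟨
    point a ⁅ b ⁆ -ℤ point b ⁅ b ⁆ ≡⟨ proj₂ (multiple Fb) ⁅ b ⁆ ⟩
    k *ℤ z ⁅ b ⁆                   ≡⟨ cong (k *ℤ_) zb≡0 ⟩
    k *ℤ 0ℤ                        ≡⟨ ℤₚ.*-zeroʳ k ⟩
    0ℤ                             ∎)
    where
    -1≢0 : -1ℤ ≢ 0ℤ
    -1≢0 ()

link⇒face : ∀ (K : Complex) {σ τ} → link K σ τ ≡ true → ∣ σ ∩ τ ∣ ≡ 0 × face K (σ ∪ τ) ≡ true
link⇒face K {σ} {τ} σ⋆τ with ∣ σ ∩ τ ∣ | face K (σ ∪ τ)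
link⇒face K σ⋆τ | zero | true = refl , refl
link⇒face K ()  | zero | false
link⇒face K ()  | suc _ | _

link-⁅u⁆ : ∀ (K : Complex) {ρ z u} → u ∉ ρ → ρ ∪ ⁅ u ⁆ ⊆ z → face K z ≡ true → link K ρ ⁅ u ⁆ ≡ true
link-⁅u⁆ K {ρ} {z} {u} u∉ρ ρu⊆z z-face =
  cong₂ _∧_ (cong (ℕ._≡ᵇ 0) (x∉p⇒∣p∩⁅x⁆∣≡0 u∉ρ)) (down K _ z ρu⊆z z-face)

Facet-≡ : ∀ {d K} {x y : Facet d K} → proj₁ x ≡ proj₁ y → x ≡ y
Facet-≡ {x = σ , f , e} {.σ , f′ , e′} refl
  rewrite UIP.Decidable⇒UIP.≡-irrelevant Boolₚ._≟_ f f′ | ℕₚ.≡-irrelevant e e′ = refl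

any-facet? : ∀ {d K} {P : Facet d K → Set} → (∀ x → Dec (P x)) → Dec (Σ (Facet d K) P)
any-facet? {d} {K} {P} P? with anySubset? isFacetWith?
  where
  isFacetWith? : ∀ σ → Dec (Σ (face K σ ≡ true) λ f → Σ (∣ σ ∣ ≡ suc d) λ e → P (σ , f , e))
  isFacetWith? σ with face K σ Boolₚ.≟ true | ∣ σ ∣ ℕₚ.≟ suc d
  ... | no ¬f | _     = no λ (f , _) → ¬f f
  ... | yes f | no ¬e = no λ (_ , e , _) → ¬e e
  ... | yes f | yes e with P? (σ , f , e)
  ...   | yes p = yes (f , e , p)
  ...   | no ¬p = no λ (f′ , e′ , p) → ¬p (subst P (Facet-≡ {d} {K} refl) p)
... | yes (σ , f , e , p) = yes ((σ , f , e) , p)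
... | no ∄σ = no λ ((σ , f , e) , p) → ∄σ (σ , f , e , p)

neighbours : ∀ {d K} (x y : Facet d K) → Adjacent d K x y → Neighbours d (proj₁ x) (proj₁ y)
neighbours (_ , _ , ∣x∣) (_ , _ , ∣y∣) x∼y = record { ∣x∣≡1+d = ∣x∣ ; ∣y∣≡1+d = ∣y∣ ; ∣x∩y∣≡d = x∼y }

module HomologyManifoldProperties {d} {K : Complex} (hm : IsHomologyManifold d K) where

  face-size : ∀ {σ} → face K σ ≡ true → 0 < ∣ σ ∣ → ∣ σ ∣ ≤ suc d
  face-size σ-face ∣σ∣>0 = proj₁ (hm _ σ-face ∣σ∣>0)

  -- The link of σ carries a nonzero class in size d + 1 − ∣σ∣, hence a face of that size.
  facet-above : ∀ {σ} → face K σ ≡ true → 0 < ∣ σ ∣ → Σ (Facet d K) λ x → σ ⊆ proj₁ x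
  facet-above {σ} σ-face ∣σ∣>0 with hm σ σ-face ∣σ∣>0
  ... | ∣σ∣≤1+d , H≅ℤ , _ with Homologyℤ⇒face H≅ℤ
  ...   | τ , σ⋆τ , ∣τ∣ with link⇒face K σ⋆τ
  ...     | disjoint , στ-face =
    (σ ∪ τ , στ-face , trans (∣p∩q∣≡0⇒∣p∪q∣≡∣p∣+∣q∣ σ τ disjoint)
                             (trans (cong (∣ σ ∣ +_) ∣τ∣) (ℕₚ.m+[n∸m]≡n ∣σ∣≤1+d))) ,
    p⊆p∪q τ

  ridge-link-has-two-vertices : 1 ≤ d → ∀ {ρ} → face K ρ ≡ true → ∣ ρ ∣ ≡ d →
    ∀ {a b c} → link K ρ ⁅ a ⁆ ≡ true → link K ρ ⁅ b ⁆ ≡ true → link K ρ ⁅ c ⁆ ≡ true →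
    a ≢ b → a ≢ c → b ≡ c
  ridge-link-has-two-vertices 1≤d {ρ} ρ-face ∣ρ∣≡d =
    Homologyℤ₁-two-vertices (subst (Homologyℤ (link K ρ)) codim≡1 (proj₁ (proj₂ (hm ρ ρ-face ∣ρ∣>0))))
                            no-edges
    where
    ∣ρ∣>0 : 0 < ∣ ρ ∣
    ∣ρ∣>0 = subst (0 <_) (sym ∣ρ∣≡d) 1≤d
    codim≡1 : suc d ∸ ∣ ρ ∣ ≡ 1
    codim≡1 rewrite ∣ρ∣≡d = ℕₚ.m+n∸n≡m 1 d
    no-edges : ∀ τ → link K ρ τ ≡ true → ∣ τ ∣ ≢ 2
    no-edges τ ρ⋆τ ∣τ∣≡2 with link⇒face K ρ⋆τ
    ... | disjoint , ρτ-face =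
      ℕₚ.<⇒≱ (ℕₚ.≤-reflexive (sym ∣ρ∪τ∣≡2+d)) (face-size ρτ-face (subst (0 <_) (sym ∣ρ∪τ∣≡2+d) (s≤s z≤n)))
      where
      ∣ρ∪τ∣≡2+d : ∣ ρ ∪ τ ∣ ≡ suc (suc d)
      ∣ρ∪τ∣≡2+d = trans (∣p∩q∣≡0⇒∣p∪q∣≡∣p∣+∣q∣ ρ τ disjoint) (trans (cong₂ _+_ ∣ρ∣≡d ∣τ∣≡2) (ℕₚ.+-comm d 2))

  neighbour-unique : 1 ≤ d → ∀ (x y y′ : Facet d K) → Adjacent d K x y → Adjacent d K x y′ →
    ∀ {a} → a ∈ proj₁ x → a ∉ proj₁ y → a ∉ proj₁ y′ → y ≡ y′
  neighbour-unique 1≤d X@(x , x-face , _) Y@(y , y-face , _) Y′@(y′ , y′-face , _) x∼y x∼y′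
                   {a} a∈x a∉y a∉y′ =
    Facet-≡ {d} {K} (begin
      y                  ≡⟨ ridge-∪-opposite xy b∈y b∉x ⟨
      (x ∩ y) ∪ ⁅ b ⁆    ≡⟨ cong₂ (λ r u → r ∪ ⁅ u ⁆) same-ridge b≡b′ ⟩
      (x ∩ y′) ∪ ⁅ b′ ⁆  ≡⟨ ridge-∪-opposite xy′ b′∈y′ b′∉x ⟩
      y′                 ∎)
    where
    open ≡-Reasoning
    xy  = neighbours {d} {K} X Y x∼y
    xy′ = neighbours {d} {K} X Y′ x∼y′
    b   = proj₁ (opposite (Neighbours-sym xy))
    b∈y = proj₁ (proj₂ (opposite (Neighbours-sym xy)))
    b∉x = proj₂ (proj₂ (opposite (Neighbours-sym xy)))
    b′   = proj₁ (opposite (Neighbours-sym xy′))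
    b′∈y′ = proj₁ (proj₂ (opposite (Neighbours-sym xy′)))
    b′∉x  = proj₂ (proj₂ (opposite (Neighbours-sym xy′)))
    same-ridge : x ∩ y ≡ x ∩ y′
    same-ridge = ⊆-antisym (ridge-⊆ xy′ a∈x a∉y a∉y′) (ridge-⊆ xy a∈x a∉y′ a∉y)
    ∉ρ : ∀ {u} → u ∉ x → u ∉ x ∩ y
    ∉ρ u∉x u∈ρ = u∉x (p∩q⊆p x y u∈ρ)
    b≡b′ : b ≡ b′
    b≡b′ = ridge-link-has-two-vertices 1≤d (down K _ x (p∩q⊆p x y) x-face) x∼y
      (link-⁅u⁆ K (λ a∈ρ → a∉y (p∩q⊆q x y a∈ρ)) (∪-least (p∩q⊆p x y) (x∈p⇒⁅x⁆⊆p a∈x)) x-face)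
      (link-⁅u⁆ K (∉ρ b∉x) (∪-least (p∩q⊆q x y) (x∈p⇒⁅x⁆⊆p b∈y)) y-face)
      (link-⁅u⁆ K (∉ρ b′∉x) (∪-least (p∩q⊆q x y′ ∘ ridge-⊆ xy′ a∈x a∉y a∉y′) (x∈p⇒⁅x⁆⊆p b′∈y′)) y′-face)
      (λ a≡b → b∉x (subst (_∈ x) a≡b a∈x))
      (λ a≡b′ → b′∉x (subst (_∈ x) a≡b′ a∈x))

  module _ (v : Fin (n K)) (S : Facet d K → Set) (S? : ∀ x → Dec (S x))
           (S-adjacent : ∀ x y → Adjacent d K x y → v ∈ proj₁ x → v ∈ proj₁ y → S x → S y) where

    private
      Spreads : ℕ → Set
      Spreads t = ∀ x y → suc d ≤ ∣ proj₁ x ∩ proj₁ y ∣ + t → v ∈ proj₁ x → v ∈ proj₁ y → S x → S y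

      module AroundFace {t} (IH : Spreads t) {ρ} (v∈ρ : v ∈ ρ) (slack : suc d ≤ ∣ ρ ∣ + suc t) where

        Around : Fin (n K) → Set
        Around u = Σ (Facet d K) λ z → ρ ⊆ proj₁ z × u ∈ proj₁ z × S z

        Around? : ∀ u → Dec (Around u)
        Around? u = any-facet? {d} {K} (λ z → (ρ ⊆? proj₁ z) ×-dec (u ∈? proj₁ z) ×-dec S? z)

        move : ∀ {u} → u ∉ ρ → Around u → ∀ z′ → ρ ⊆ proj₁ z′ → u ∈ proj₁ z′ → S z′
        move {u} u∉ρ (z , ρ⊆z , u∈z , Sz) z′ ρ⊆z′ u∈z′ = IH z z′ bound (ρ⊆z v∈ρ) (ρ⊆z′ v∈ρ) Sz
          where
          1+∣ρ∣≤∣z∩z′∣ : suc ∣ ρ ∣ ≤ ∣ proj₁ z ∩ proj₁ z′ ∣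
          1+∣ρ∣≤∣z∩z′∣ = subst (_≤ ∣ proj₁ z ∩ proj₁ z′ ∣) (x∉p⇒∣p∪⁅x⁆∣≡1+∣p∣ u∉ρ)
            (p⊆q⇒∣p∣≤∣q∣ (∪-least (λ w∈ρ → x∈p∩q⁺ (ρ⊆z w∈ρ , ρ⊆z′ w∈ρ)) (x∈p⇒⁅x⁆⊆p (x∈p∩q⁺ (u∈z , u∈z′)))))
          bound : suc d ≤ ∣ proj₁ z ∩ proj₁ z′ ∣ + t
          bound = ℕₚ.≤-trans slack
                    (ℕₚ.≤-trans (ℕₚ.≤-reflexive (ℕₚ.+-suc ∣ ρ ∣ t)) (ℕₚ.+-monoˡ-≤ t 1+∣ρ∣≤∣z∩z′∣))

        Around-edgeClosed : EdgeClosed (link K ρ) Around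
        Around-edgeClosed {u} {w} _ ρ⋆uw Au =
          z′ , ρ⊆z′ , uw⊆z′ (x∈p∪q⁺ (inj₂ (x∈⁅x⁆ w))) ,
          move u∉ρ Au z′ ρ⊆z′ (uw⊆z′ (x∈p∪q⁺ (inj₁ (x∈⁅x⁆ u))))
          where
          above = facet-above (proj₂ (link⇒face K ρ⋆uw)) (x∈p⇒∣p∣>0 (x∈p∪q⁺ (inj₁ v∈ρ)))
          z′ = proj₁ above
          ρ⊆z′ : ρ ⊆ proj₁ z′
          ρ⊆z′ w∈ρ = proj₂ above (x∈p∪q⁺ (inj₁ w∈ρ))
          uw⊆z′ : ⁅ u ⁆ ∪ ⁅ w ⁆ ⊆ proj₁ z′
          uw⊆z′ h = proj₂ above (x∈p∪q⁺ (inj₂ h))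
          u∉ρ : u ∉ ρ
          u∉ρ u∈ρ = ∣p∩q∣≡0⇒x∉q (proj₁ (link⇒face K ρ⋆uw)) u∈ρ (x∈p∪q⁺ (inj₁ (x∈⁅x⁆ u)))

      -- Two facets through v meeting in a face ρ of codimension ≥ 2 are joined through the
      -- link of ρ, which is connected because its reduced H₀ vanishes.
      spreads-across : ∀ {t} → Spreads t → ∀ x y → ∣ proj₁ x ∩ proj₁ y ∣ < d →
        suc d ≤ ∣ proj₁ x ∩ proj₁ y ∣ + suc t → v ∈ proj₁ x → v ∈ proj₁ y → S x → S y
      spreads-across IH X@(x , x-face , ∣x∣) Y@(y , y-face , ∣y∣) ρ<d slack v∈x v∈y Sx =
        move a′∉ρ reach-a′ Y (p∩q⊆q x y) a′∈y
        where
        ρ = x ∩ y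
        open AroundFace IH (x∈p∩q⁺ (v∈x , v∈y)) slack
        ρ<1+d : ∣ ρ ∣ < suc d
        ρ<1+d = ℕₚ.m<n⇒m<1+n ρ<d
        a-opp  = ∣p∩q∣<∣p∣⇒∃∉ x y (subst (∣ ρ ∣ <_) (sym ∣x∣) ρ<1+d)
        a′-opp = ∣p∩q∣<∣p∣⇒∃∉ y x (subst₂ _<_ (cong ∣_∣ (∩-comm x y)) (sym ∣y∣) ρ<1+d)
        a = proj₁ a-opp
        a∈x = proj₁ (proj₂ a-opp)
        a′ = proj₁ a′-opp
        a′∈y = proj₁ (proj₂ a′-opp)
        a′∉ρ : a′ ∉ ρ
        a′∉ρ a′∈ρ = proj₂ (proj₂ a′-opp) (p∩q⊆p x y a′∈ρ)
        a∉ρ : a ∉ ρ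
        a∉ρ a∈ρ = proj₂ (proj₂ a-opp) (p∩q⊆q x y a∈ρ)
        1≢codim : 1 ≢ suc d ∸ ∣ ρ ∣
        1≢codim 1≡codim = ℕₚ.<⇒≢ (ℕₚ.m<n⇒0<n∸m ρ<d)
                                 (ℕₚ.suc-injective (trans 1≡codim (ℕₚ.+-∸-assoc 1 (ℕₚ.<⇒≤ ρ<d))))
        H̃₀≡0 : HomologyZero (link K ρ) 1
        H̃₀≡0 = proj₂ (proj₂ (hm ρ ρ-face (x∈p⇒∣p∣>0 (x∈p∩q⁺ (v∈x , v∈y))))) 1 1≢codim
          where ρ-face = down K ρ x (p∩q⊆p x y) x-face
        bounds : IsBoundary (link K ρ) 1 (point a -ᶜ point a′)
        bounds = H̃₀≡0 _ (point-difference-isCycle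
          (link-⁅u⁆ K a∉ρ (∪-least (p∩q⊆p x y) (x∈p⇒⁅x⁆⊆p a∈x)) x-face)
          (link-⁅u⁆ K a′∉ρ (∪-least (p∩q⊆q x y) (x∈p⇒⁅x⁆⊆p a′∈y)) y-face))
        reach-a′ : Around a′
        reach-a′ = EdgeClosed-bounding Around? Around-edgeClosed bounds (X , p∩q⊆p x y , a∈x , Sx)

      spreads : ∀ t → Spreads t
      spreads zero (x , _ , ∣x∣) (y , _ , ∣y∣) bound _ _ Sx =
        subst S (Facet-≡ {d} {K} (trans (sym x∩y≡x) x∩y≡y)) Sx
        where
        1+d≤∣x∩y∣ : suc d ≤ ∣ x ∩ y ∣
        1+d≤∣x∩y∣ = subst (suc d ≤_) (ℕₚ.+-identityʳ _) bound
        x∩y≡x : x ∩ y ≡ x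
        x∩y≡x = p⊆q∧∣q∣≤∣p∣⇒p≡q (p∩q⊆p x y) (subst (_≤ ∣ x ∩ y ∣) (sym ∣x∣) 1+d≤∣x∩y∣)
        x∩y≡y : x ∩ y ≡ y
        x∩y≡y = p⊆q∧∣q∣≤∣p∣⇒p≡q (p∩q⊆q x y) (subst (_≤ ∣ x ∩ y ∣) (sym ∣y∣) 1+d≤∣x∩y∣)
      spreads (suc t) x y bound v∈x v∈y Sx
        with suc d ℕₚ.≤? ∣ proj₁ x ∩ proj₁ y ∣ + t | ∣ proj₁ x ∩ proj₁ y ∣ ℕₚ.≟ d
      ... | yes bound′ | _        = spreads t x y bound′ v∈x v∈y Sx
      ... | no _       | yes x∼y  = S-adjacent x y x∼y v∈x v∈y Sx
      ... | no ¬bound′ | no ∣x∩y∣≢d =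
        spreads-across (spreads t) x y (ℕₚ.≤∧≢⇒< ∣x∩y∣≤d ∣x∩y∣≢d) bound v∈x v∈y Sx
        where
        ∣x∩y∣≤d : ∣ proj₁ x ∩ proj₁ y ∣ ≤ d
        ∣x∩y∣≤d = ℕₚ.≤-trans (ℕₚ.m≤m+n _ t) (ℕₚ.≤-pred (ℕₚ.≰⇒> ¬bound′))

    star-connected : ∀ x y → v ∈ proj₁ x → v ∈ proj₁ y → S x → S y
    star-connected x y = spreads (suc d) x y (ℕₚ.m≤n+m (suc d) _)

-- From maps of dual graphs to vertex maps

Adjacent-sym : ∀ {d K} (x y : Facet d K) → Adjacent d K x y → Adjacent d K y x
Adjacent-sym (x , _) (y , _) x∼y = trans (cong ∣_∣ (∩-comm y x)) x∼y

∈-image⁻ : ∀ {n n′} {g : Fin n′ → Fin n} {σ j} → j ∈ image g σ → g j ∈ σ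
∈-image⁻ {g = g} {σ} {j} j∈ =
  Vecₚ.lookup⇒[]= (g j) σ (trans (sym (Vecₚ.lookup∘tabulate (λ i → lookup σ (g i)) j)) (Vecₚ.[]=⇒lookup j∈))

image-image : ∀ {n n′} {f : Fin n → Fin n′} {g : Fin n′ → Fin n} → (∀ i → g (f i) ≡ i) →
              ∀ σ → image f (image g σ) ≡ σ
image-image {f = f} {g} g∘f≗id σ = trans
  (Vecₚ.tabulate-cong (λ i → trans (Vecₚ.lookup∘tabulate (λ j → lookup σ (g j)) (f i))
                                   (cong (lookup σ) (g∘f≗id i))))
  (Vecₚ.tabulate∘lookup σ)

record DualMap (d : ℕ) (K K′ : Complex) : Set where
  field
    apply    : Facet d K → Facet d K′
    adjacent : ∀ x y → Adjacent d K x y → Adjacent d K′ (apply x) (apply y)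
    coherent : ∀ x y → Adjacent d K x y →
               OppositeRanksAgree (proj₁ x) (proj₁ y) (proj₁ (apply x)) (proj₁ (apply y))

module VertexMap {d K K′} (hm : IsHomologyManifold d K) (φ : DualMap d K K′) where
  open DualMap φ
  open HomologyManifoldProperties {d} {K} hm

  -- Abstract, so that comparing vertices never unfolds the search for a facet.
  abstract
    home : ∀ v → Σ (Facet d K) λ x → v ∈ proj₁ x
    home v with facet-above {⁅ v ⁆} (vertices K v) (x∈p⇒∣p∣>0 (x∈⁅x⁆ v))
    ... | x , ⁅v⁆⊆x = x , ⁅v⁆⊆x (x∈⁅x⁆ v)

    sameRank : ∀ x {v} → v ∈ proj₁ x → ∃ (SameRank (proj₁ x) v (proj₁ (apply x)))
    sameRank x@(_ , _ , ∣x∣) {v} v∈x = rank-surjective (proj₁ (apply x)) _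
      (subst (rank (proj₁ x) v <_) (trans ∣x∣ (sym (proj₂ (proj₂ (apply x))))) (rank<∣p∣ v∈x))

    vertex : Fin (n K) → Fin (n K′)
    vertex v = proj₁ (sameRank (proj₁ (home v)) (proj₂ (home v)))

    vertex-home : ∀ v → SameRank (proj₁ (proj₁ (home v))) v (proj₁ (apply (proj₁ (home v)))) (vertex v)
    vertex-home v = proj₂ (sameRank (proj₁ (home v)) (proj₂ (home v)))

  vertex-sameRank : ∀ x {v} → v ∈ proj₁ x → SameRank (proj₁ x) v (proj₁ (apply x)) (vertex v)
  vertex-sameRank x {v} v∈x =
    star-connected v S S? S-adjacent (proj₁ (home v)) x (proj₂ (home v)) v∈x (vertex-home v)
    where
    S : Facet d K → Set
    S y = SameRank (proj₁ y) v (proj₁ (apply y)) (vertex v)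
    S? : ∀ y → Dec (S y)
    S? y = (vertex v ∈? proj₁ (apply y)) ×-dec (rank (proj₁ (apply y)) (vertex v) ℕₚ.≟ rank (proj₁ y) v)
    S-adjacent : ∀ y z → Adjacent d K y z → v ∈ proj₁ y → v ∈ proj₁ z → S y → S z
    S-adjacent y z y∼z v∈y v∈z Sy = subst (SameRank (proj₁ z) v (proj₁ (apply z))) (sym vertex≡w) w~v
      where
      w~v = proj₂ (sameRank z v∈z)
      vertex≡w : vertex v ≡ proj₁ (sameRank z v∈z)
      vertex≡w = rank-transfer (neighbours {d} {K} y z y∼z)
                               (neighbours {d} {K′} (apply y) (apply z) (adjacent y z y∼z))
                               (coherent y z y∼z) (coherent z y (Adjacent-sym {d} {K} y z y∼z))
                               v∈y v∈z Sy w~v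

  image-face : (g : Fin (n K′) → Fin (n K)) → (∀ j → vertex (g j) ≡ j) →
               ∀ {σ} → face K σ ≡ true → face K′ (image g σ) ≡ true
  image-face g vertex∘g≗id {σ} σ-face with nonempty? (image g σ)
  ... | no ∅-image = trans (cong (face K′) (Empty-unique ∅-image)) (empty K′)
  ... | yes (j , j∈) with facet-above {σ} σ-face (x∈p⇒∣p∣>0 {p = σ} (∈-image⁻ {g = g} {σ} j∈))
  ...   | x , σ⊆x = down K′ _ (proj₁ (apply x)) image⊆φx (proj₁ (proj₂ (apply x)))
    where
    image⊆φx : image g σ ⊆ proj₁ (apply x)
    image⊆φx {i} i∈ = subst (_∈ proj₁ (apply x)) (vertex∘g≗id i)
                            (proj₁ (vertex-sameRank x (σ⊆x (∈-image⁻ {g = g} i∈))))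

vertex-inverse : ∀ {d K K′} (hm : IsHomologyManifold d K) (hm′ : IsHomologyManifold d K′)
  (φ : DualMap d K K′) (ψ : DualMap d K′ K) → (∀ x → DualMap.apply ψ (DualMap.apply φ x) ≡ x) →
  ∀ v → VertexMap.vertex hm′ ψ (VertexMap.vertex hm φ v) ≡ v
vertex-inverse {d} {K} hm hm′ φ ψ ψ∘φ≗id v = rank-injective g[f[v]]∈x v∈x (begin
  rank (proj₁ x) (g (f v))          ≡⟨ cong (λ y → rank (proj₁ y) (g (f v))) (ψ∘φ≗id x) ⟨
  rank (proj₁ (ψ′ (φ′ x))) (g (f v)) ≡⟨ proj₂ g[f[v]]≈f[v] ⟩
  rank (proj₁ (φ′ x)) (f v)         ≡⟨ proj₂ f[v]≈v ⟩
  rank (proj₁ x) v                  ∎)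
  where
  open ≡-Reasoning
  module Φ = VertexMap hm φ
  module Ψ = VertexMap hm′ ψ
  φ′ = DualMap.apply φ
  ψ′ = DualMap.apply ψ
  f = Φ.vertex
  g = Ψ.vertex
  x = proj₁ (Φ.home v)
  v∈x = proj₂ (Φ.home v)
  f[v]≈v = Φ.vertex-sameRank x v∈x
  g[f[v]]≈f[v] = Ψ.vertex-sameRank (φ′ x) (proj₁ f[v]≈v)
  g[f[v]]∈x : g (f v) ∈ proj₁ x
  g[f[v]]∈x = subst (λ y → g (f v) ∈ proj₁ y) (ψ∘φ≗id x) (proj₁ g[f[v]]≈f[v])

inverse-DualMaps⇒SimpIso : ∀ {d K K′} → IsHomologyManifold d K → IsHomologyManifold d K′ →
  (φ : DualMap d K K′) (ψ : DualMap d K′ K) →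
  (∀ x → DualMap.apply ψ (DualMap.apply φ x) ≡ x) → (∀ y → DualMap.apply φ (DualMap.apply ψ y) ≡ y) →
  SimpIso K K′
inverse-DualMaps⇒SimpIso {K = K} {K′} hm hm′ φ ψ ψ∘φ≗id φ∘ψ≗id = mk↔ₛ′ f g f∘g≗id g∘f≗id , faces
  where
  f = VertexMap.vertex hm φ
  g = VertexMap.vertex hm′ ψ
  g∘f≗id = vertex-inverse hm hm′ φ ψ ψ∘φ≗id
  f∘g≗id = vertex-inverse hm′ hm ψ φ φ∘ψ≗id
  faces : ∀ σ → face K′ (image g σ) ≡ face K σ
  faces σ with face K σ in σ-face | face K′ (image g σ) in gσ-face
  ... | true  | true  = refl
  ... | false | false = refl
  ... | true  | false = trans (sym gσ-face) (VertexMap.image-face hm φ g f∘g≗id σ-face)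
  ... | false | true  = trans (sym (subst (λ τ → face K τ ≡ true) (image-image {f = f} {g} g∘f≗id σ)
                                         (VertexMap.image-face hm′ ψ f g∘f≗id gσ-face))) σ-face

-- Colourings

missed-value : ∀ B (h : Fin B → Fin (suc B)) → ∃ λ c → ∀ k → h k ≢ c
missed-value B h with Finₚ.any? (λ c → Finₚ.all? (λ k → ¬? (h k Fin.≟ c)))
... | yes missing = missing
... | no ∄missing = ⊥-elim (Finₚ.<⇒≢ i<j (begin
  i                ≡⟨ h∘pre≗id i ⟨
  h (pre i)        ≡⟨ cong h pre-i≡pre-j ⟩
  h (pre j)        ≡⟨ h∘pre≗id j ⟩
  j                ∎))
  where
  open ≡-Reasoning
  preimage : ∀ c → ∃ λ k → h k ≡ c
  preimage c with Finₚ.any? (λ k → h k Fin.≟ c)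
  ... | yes hit = hit
  ... | no ∄k = ⊥-elim (∄missing (c , λ k hk≡c → ∄k (k , hk≡c)))
  pre : Fin (suc B) → Fin B
  pre c = proj₁ (preimage c)
  h∘pre≗id : ∀ c → h (pre c) ≡ c
  h∘pre≗id c = proj₂ (preimage c)
  collision = Finₚ.pigeonhole (ℕₚ.n<1+n B) pre
  i = proj₁ collision
  j = proj₁ (proj₂ collision)
  i<j = proj₁ (proj₂ (proj₂ collision))
  pre-i≡pre-j = proj₂ (proj₂ (proj₂ collision))

module Greedy {A : Set} (_≟_ : DecidableEquality A) {B} (nbr : A → Fin B → A) where

  colourList : List A → A → Fin (suc B)
  colourList []       y = zero
  colourList (x ∷ xs) y =
    if does (y ≟ x) then proj₁ (missed-value B (colourList xs ∘ nbr x)) else colourList xs y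

  colourList-proper : ∀ xs {u w} → u ∈ˡ xs → w ∈ˡ xs → u ≢ w →
    (∃ λ k → nbr u k ≡ w) → (∃ λ k → nbr w k ≡ u) → colourList xs u ≢ colourList xs w
  colourList-proper (x ∷ xs) {u} {w} u∈ w∈ u≢w (k , u→w) (l , w→u) with u ≟ x | w ≟ x
  ... | yes refl | yes refl = ⊥-elim (u≢w refl)
  ... | yes refl | no _     = λ eq → proj₂ (missed-value B (colourList xs ∘ nbr u)) k
                                       (trans (cong (colourList xs) u→w) (sym eq))
  ... | no _     | yes refl = λ eq → proj₂ (missed-value B (colourList xs ∘ nbr w)) l
                                       (trans (cong (colourList xs) w→u) eq)
  ... | no u≢x   | no w≢x   = colourList-proper xs (tail u∈ u≢x) (tail w∈ w≢x) u≢w (k , u→w) (l , w→u)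
    where
    tail : ∀ {y} → y ∈ˡ x ∷ xs → y ≢ x → y ∈ˡ xs
    tail (here y≡x) y≢x = ⊥-elim (y≢x y≡x)
    tail (there y∈) _   = y∈

allSubsets : ∀ n → List (Subset n)
allSubsets zero    = [] ∷ []
allSubsets (suc n) = List.map (true ∷_) (allSubsets n) ++ List.map (false ∷_) (allSubsets n)

∈-allSubsets : ∀ {n} (σ : Subset n) → σ ∈ˡ allSubsets n
∈-allSubsets []          = here refl
∈-allSubsets (true ∷ σ)  = Anyₚ.++⁺ˡ (Anyₚ.map⁺ (Any.map (cong (true ∷_)) (∈-allSubsets σ)))
∈-allSubsets {suc n} (false ∷ σ) =
  Anyₚ.++⁺ʳ (List.map (true ∷_) (allSubsets n)) (Anyₚ.map⁺ (Any.map (cong (false ∷_)) (∈-allSubsets σ)))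

record ReadableColouring (d : ℕ) : Set where
  field
    N             : ℕ
    colour        : (M : HomologyManifold d) → Facet d (proj₁ M) → Fin N
    read          : Fin N → Fin N → ℕ
    read-opposite : ∀ M (x y : Facet d (proj₁ M)) → Adjacent d (proj₁ M) x y →
                    ∀ {a} → a ∈ proj₁ x → a ∉ proj₁ y → read (colour M x) (colour M y) ≡ rank (proj₁ x) a

-- A facet has at most d + 1 neighbours, so at most (d + 1)² facets lie two steps away.
palette : ℕ → ℕ
palette d = suc (suc d * suc d)

-- A colour is a pair (c , t): c separates facets at distance two, and t sends the
-- colour of each neighbour to the rank of the vertex it does not share.
readTable : ∀ d → Fin (palette d * suc d ^ palette d) → Fin (palette d * suc d ^ palette d) → ℕ
readTable d p q = toℕ (Fin.finToFun (Fin.remainder {palette d} (suc d ^ palette d) p)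
                                    (Fin.quotient {palette d} (suc d ^ palette d) q))

module OppositeTable {d} {K : Complex} (hm : IsHomologyManifold d K) (1≤d : 1 ≤ d) where
  open HomologyManifoldProperties {d} {K} hm

  Across : Subset (n K) → Fin (suc d) → Subset (n K) → Set
  Across x i y = face K y ≡ true × ∣ y ∣ ≡ suc d × ∣ x ∩ y ∣ ≡ d × ∃ λ a → a ∈ x × a ∉ y × rank x a ≡ toℕ i

  Across? : ∀ x i y → Dec (Across x i y)
  Across? x i y = (face K y Boolₚ.≟ true) ×-dec (∣ y ∣ ℕₚ.≟ suc d) ×-dec (∣ x ∩ y ∣ ℕₚ.≟ d) ×-dec
                  Finₚ.any? (λ a → (a ∈? x) ×-dec ¬? (a ∈? y) ×-dec (rank x a ℕₚ.≟ toℕ i))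

  rankIndex : ∀ (x : Facet d K) {a} → a ∈ proj₁ x → Fin (suc d)
  rankIndex (x , _ , ∣x∣) a∈x = Fin.fromℕ< (subst (rank x _ <_) ∣x∣ (rank<∣p∣ a∈x))

  toℕ-rankIndex : ∀ (x : Facet d K) {a} (a∈x : a ∈ proj₁ x) → toℕ (rankIndex x a∈x) ≡ rank (proj₁ x) a
  toℕ-rankIndex (x , _ , ∣x∣) a∈x = Finₚ.toℕ-fromℕ< (subst (rank x _ <_) ∣x∣ (rank<∣p∣ a∈x))

  across : ∀ (x y : Facet d K) → Adjacent d K x y → ∀ {a} (a∈x : a ∈ proj₁ x) → a ∉ proj₁ y →
           Across (proj₁ x) (rankIndex x a∈x) (proj₁ y)
  across x (y , y-face , ∣y∣) x∼y a∈x a∉y = y-face , ∣y∣ , x∼y , _ , a∈x , a∉y , sym (toℕ-rankIndex x a∈x)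

  across-unique : ∀ (x : Facet d K) {i y y′} → Across (proj₁ x) i y → Across (proj₁ x) i y′ → y ≡ y′
  across-unique x {y = y} {y′} (y-face , ∣y∣ , x∼y , a , a∈x , a∉y , a~i)
                               (y′-face , ∣y′∣ , x∼y′ , a′ , a′∈x , a′∉y′ , a′~i) =
    cong proj₁ (neighbour-unique 1≤d x (y , y-face , ∣y∣) (y′ , y′-face , ∣y′∣) x∼y x∼y′ a∈x a∉y
                 (subst (_∉ y′) (rank-injective a′∈x a∈x (trans a′~i (sym a~i))) a′∉y′))

  neighbour : Subset (n K) → Fin (suc d) → Subset (n K)
  neighbour x i with anySubset? (Across? x i)
  ... | yes (y , _) = y
  ... | no _        = x

  neighbour-across : ∀ (x : Facet d K) {i y} → Across (proj₁ x) i y → neighbour (proj₁ x) i ≡ y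
  neighbour-across x {i} x→y with anySubset? (Across? (proj₁ x) i)
  ... | yes (y′ , x→y′) = across-unique x x→y′ x→y
  ... | no ∄y = ⊥-elim (∄y (_ , x→y))

  twoSteps : Subset (n K) → Fin (suc d * suc d) → Subset (n K)
  twoSteps x k = neighbour (neighbour x (Fin.quotient {suc d} (suc d) k)) (Fin.remainder {suc d} (suc d) k)

  twoSteps-reach : ∀ (x y z : Facet d K) → Adjacent d K y x → Adjacent d K x z →
                   ∃ λ k → twoSteps (proj₁ y) k ≡ proj₁ z
  twoSteps-reach x y z y∼x x∼z = Fin.combine (rankIndex y b∈y) (rankIndex x a∈x) , (begin
    twoSteps (proj₁ y) (Fin.combine (rankIndex y b∈y) (rankIndex x a∈x))
      ≡⟨ cong (λ (i , j) → neighbour (neighbour (proj₁ y) i) j)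
              (Finₚ.remQuot-combine (rankIndex y b∈y) (rankIndex x a∈x)) ⟩
    neighbour (neighbour (proj₁ y) (rankIndex y b∈y)) (rankIndex x a∈x)
      ≡⟨ cong (λ w → neighbour w (rankIndex x a∈x)) (neighbour-across y (across y x y∼x b∈y b∉x)) ⟩
    neighbour (proj₁ x) (rankIndex x a∈x)
      ≡⟨ neighbour-across x (across x z x∼z a∈x a∉z) ⟩
    proj₁ z ∎)
    where
    open ≡-Reasoning
    b∈y = proj₁ (proj₂ (opposite (neighbours {d} {K} y x y∼x)))
    b∉x = proj₂ (proj₂ (opposite (neighbours {d} {K} y x y∼x)))
    a∈x = proj₁ (proj₂ (opposite (neighbours {d} {K} x z x∼z)))
    a∉z = proj₂ (proj₂ (opposite (neighbours {d} {K} x z x∼z)))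

  open Greedy _≟ₛ_ twoSteps

  separator : Subset (n K) → Fin (palette d)
  separator = colourList (allSubsets (n K))

  separator-injective : ∀ (x y y′ : Facet d K) → Adjacent d K x y → Adjacent d K x y′ →
                        separator (proj₁ y) ≡ separator (proj₁ y′) → proj₁ y ≡ proj₁ y′
  separator-injective x y y′ x∼y x∼y′ same with proj₁ y ≟ₛ proj₁ y′
  ... | yes y≡y′ = y≡y′
  ... | no y≢y′ = ⊥-elim (colourList-proper (allSubsets (n K)) (∈-allSubsets _) (∈-allSubsets _) y≢y′
                            (twoSteps-reach x y y′ (Adjacent-sym {d} {K} x y x∼y) x∼y′)
                            (twoSteps-reach x y′ y (Adjacent-sym {d} {K} x y′ x∼y′) x∼y) same)

  table : Subset (n K) → Fin (palette d) → Fin (suc d)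
  table x c with Finₚ.any? (λ i → Across? x i (neighbour x i) ×-dec (separator (neighbour x i) Fin.≟ c))
  ... | yes (i , _) = i
  ... | no _        = zero

  table-opposite : ∀ (x y : Facet d K) → Adjacent d K x y → ∀ {a} → a ∈ proj₁ x → a ∉ proj₁ y →
                   toℕ (table (proj₁ x) (separator (proj₁ y))) ≡ rank (proj₁ x) a
  table-opposite x y x∼y {a} a∈x a∉y
    with Finₚ.any? (λ i → Across? (proj₁ x) i (neighbour (proj₁ x) i)
                          ×-dec (separator (neighbour (proj₁ x) i) Fin.≟ separator (proj₁ y)))
  ... | no ∄i = ⊥-elim (∄i (rankIndex x a∈x ,
                            subst (Across (proj₁ x) _) (sym x→y) (across x y x∼y a∈x a∉y) ,
                            cong separator x→y))
    where
    x→y = neighbour-across x (across x y x∼y a∈x a∉y)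
  ... | yes (i , (z-face , ∣z∣ , x∼z , a′ , a′∈x , a′∉z , a′~i) , same) =
    trans (sym a′~i)
          (cong (rank (proj₁ x)) (opposite-unique (neighbours {d} {K} x y x∼y) a∈x a∉y a′∈x a′∉y))
    where
    z≡y = separator-injective x (neighbour (proj₁ x) i , z-face , ∣z∣) y x∼z x∼y same
    a′∉y = subst (a′ ∉_) z≡y a′∉z

  colour : Facet d K → Fin (palette d * suc d ^ palette d)
  colour (x , _) = Fin.combine (separator x) (Fin.funToFin (table x))

  readTable-colour : ∀ (x y : Facet d K) →
                     readTable d (colour x) (colour y) ≡ toℕ (table (proj₁ x) (separator (proj₁ y)))
  readTable-colour X@(x , _) Y@(y , _) = begin
    readTable d (colour X) (colour Y)
      ≡⟨ cong₂ (λ t c → toℕ (Fin.finToFun t c))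
               (cong proj₂ (combine-split x)) (cong proj₁ (combine-split y)) ⟩
    toℕ (Fin.finToFun (Fin.funToFin (table x)) (separator y))
      ≡⟨ cong toℕ (Finₚ.finToFun-funToFin (table x) (separator y)) ⟩
    toℕ (table x (separator y)) ∎
    where
    open ≡-Reasoning
    combine-split : ∀ z → Fin.remQuot {palette d} (suc d ^ palette d)
                                      (Fin.combine (separator z) (Fin.funToFin (table z)))
                          ≡ (separator z , Fin.funToFin (table z))
    combine-split z =
      Finₚ.remQuot-combine {palette d} {suc d ^ palette d} (separator z) (Fin.funToFin (table z))

readableColouring : ∀ d → ReadableColouring d
readableColouring zero = record
  { N             = 1
  ; colour        = λ _ _ → zero
  ; read          = λ _ _ → 0
  ; read-opposite = λ _ (x , _ , ∣x∣) _ _ a∈x _ → sym (ℕₚ.n<1⇒n≡0 (subst (rank x _ <_) ∣x∣ (rank<∣p∣ a∈x)))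
  }
readableColouring d@(suc _) = record
  { N             = palette d * suc d ^ palette d
  ; colour        = λ (K , hm) → OppositeTable.colour {d} {K} hm (s≤s z≤n)
  ; read          = readTable d
  ; read-opposite = λ (K , hm) x y x∼y a∈x a∉y →
      trans (OppositeTable.readTable-colour {d} {K} hm (s≤s z≤n) x y)
            (OppositeTable.table-opposite {d} {K} hm (s≤s z≤n) x y x∼y a∈x a∉y)
  }

module _ {d} (R : ReadableColouring d) where
  open ReadableColouring R

  colour-preserving⇒DualMap : ∀ M M′ (φ : Facet d (proj₁ M) → Facet d (proj₁ M′)) →
    (∀ x y → Adjacent d (proj₁ M) x y → Adjacent d (proj₁ M′) (φ x) (φ y)) →
    (∀ x → colour M′ (φ x) ≡ colour M x) → DualMap d (proj₁ M) (proj₁ M′)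
  colour-preserving⇒DualMap M M′ φ adjacent same-colour = record
    { apply    = φ
    ; adjacent = adjacent
    ; coherent = λ x y x∼y {a} {a′} a∈x a∉y a′∈φx a′∉φy → begin
        rank (proj₁ x) a                          ≡⟨ read-opposite M x y x∼y a∈x a∉y ⟨
        read (colour M x) (colour M y)            ≡⟨ cong₂ read (same-colour x) (same-colour y) ⟨
        read (colour M′ (φ x)) (colour M′ (φ y))  ≡⟨ read-opposite M′ (φ x) (φ y) (adjacent x y x∼y)
                                                                    a′∈φx a′∉φy ⟩
        rank (proj₁ (φ x)) a′                     ∎
    }
    where open ≡-Reasoning

  ColouredDualIso⇒SimpIso : ∀ M M′ → ColouredDualIso d N (proj₁ M) (proj₁ M′) (colour M) (colour M′) →
                            SimpIso (proj₁ M) (proj₁ M′)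
  ColouredDualIso⇒SimpIso M@(K , hm) M′@(K′ , hm′) (φ , adjacent-to , adjacent-from , same-colour) =
    inverse-DualMaps⇒SimpIso hm hm′
      (colour-preserving⇒DualMap M M′ to adjacent-to same-colour)
      (colour-preserving⇒DualMap M′ M from adjacent-from′ same-colour′)
      strictlyInverseʳ strictlyInverseˡ
    where
    open Inverse φ
    adjacent-from′ : ∀ x y → Adjacent d K′ x y → Adjacent d K (from x) (from y)
    adjacent-from′ x y x∼y =
      adjacent-from (from x) (from y)
                    (subst₂ (Adjacent d K′) (sym (strictlyInverseˡ x)) (sym (strictlyInverseˡ y)) x∼y)
    same-colour′ : ∀ x → colour M (from x) ≡ colour M′ x
    same-colour′ x = trans (sym (same-colour (from x))) (cong (colour M′) (strictlyInverseˡ x))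

proposition7p4 : (d : ℕ) → Σ ℕ λ N →
    Σ ((M : HomologyManifold d) → Facet d (proj₁ M) → Fin N) λ col →
    (M M' : HomologyManifold d) →
    ColouredDualIso d N (proj₁ M) (proj₁ M') (col M) (col M') →
    SimpIso (proj₁ M) (proj₁ M')
proposition7p4 d = N , colour , ColouredDualIso⇒SimpIso R
  where
  R = readableColouring d
  open ReadableColouring R
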